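{- Let $D\ge2$ be squarefree, $K=\mathbb{Q}(\sqrt D)$, $j\in\mathbb{Z}$, and $\alpha=2\beta_j+\beta_{j+1}$. Then: if $v_j\ge3$ and $(v_j,v_{j+1})\ne(3,2)$, then $p_K(\alpha)=4$; if $(v_j,v_{j+1})=(3,2)$, then $p_K(\alpha)=5$; if $v_j=2$ and $v_{j+1}\ge4$, then $p_K(\alpha)=6$; if $v_j=2$, $v_{j+1}=3$ and $v_{j-1}>2$, then $p_K(\alpha)=6$; if $v_j=2$, $v_{j+1}=3$ and $v_{j-1}=2$, then $p_K(\alpha)=7$; if $v_j=2$ and $v_{j+1}=2$, then $p_K(\alpha)\ge8$.
   Context: $\mathcal{O}_K^+$: totally positive integers of $K$; $p_K(\alpha)$ is the number of unordered representations $\alpha=\lambda_1+\dots+\lambda_\ell$ ($\ell\ge1$, $\lambda_i\in\mathcal{O}_K^+$). Notation: $\omega_D=\sqrt D$, $\xi_D=\sqrt D$ if $D\equiv2,3\pmod4$; $\omega_D=(1+\sqrt D)/2$, $\xi_D=(\sqrt D-1)/2$ if $D\equiv1\pmod4$. Write $\omega_D=[\lceil u_0/2\rceil;\overline{u_1,\dots,u_s}]$ with $u_s=u_0$ (indices extended periodically). Let $p_{ -1}=1,q_{ -1}=0$, $p_0=\lceil u_0/2\rceil,q_0=1$, $p_{i+2}=u_{i+2}p_{i+1}+p_i$, $q_{i+2}=u_{i+2}q_{i+1}+q_i$, $\alpha_i=p_i+q_i\xi_D$, $\alpha_{i,r}=\alpha_i+r\alpha_{i+1}$. The indecomposables of $\mathcal{O}_K^+$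 (elements not a sum of two elements of $\mathcal{O}_K^+$) are the $\alpha_{i,r}$ ($i\ge-1$ odd, $0\le r\le u_{i+2}-1$) and their Galois conjugates, ordered as $\dots<\beta_{ -1}<\beta_0=1<\beta_1<\dots$ with $\beta_{ -j}=\beta_j'$ ($\beta_j$, $j\ge0$, runs through the $\alpha_{i,r}$ in lexicographic order of $(i,r)$). For $j\in\mathbb{Z}$, $v_j=2$ if $\beta_{|j|}=\alpha_{i,r}$ with $1\le r\le u_{i+2}-1$, and $v_j=u_{i+1}+2$ if $\beta_{|j|}=\alpha_{i,0}$; one has $v_j\beta_j=\beta_{j-1}+\beta_{j+1}$. -}

module Defs where

open import Data.Nat as ℕ using (ℕ; _%_)
open import Data.Nat.Divisibility using (_∣_)
open import Data.Integer as ℤ using (ℤ; +_; _+_; _*_; _-_; _<_; _≤_; 0ℤ)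
open import Data.Product using (Σ; _×_; _,_; ∃)
open import Data.Sum using (_⊎_)
open import Data.List using (List; []; _∷_; length)
open import Data.List.Relation.Unary.All using (All)
open import Data.List.Relation.Unary.Any using (Any)
open import Data.List.Relation.Unary.AllPairs using (AllPairs)
open import Data.List.Relation.Binary.Permutation.Propositional using (_↭_)
open import Relation.Nullary using (¬_)
open import Relation.Binary.PropositionalEquality using (_≡_; _≢_)

Squarefree : ℕ → Set
Squarefree D = ∀ (m : ℕ) → (m ℕ.* m) ∣ D → m ≡ 1

-- An element of O_K, K = Q(√D), written as x + y·ω_D with (x , y) : ℤ × ℤ
OK : Set
OK = ℤ × ℤ

_⊕_ : OK → OK → OK
(a , b) ⊕ (c , d) = (a + c , b + d)

_⊖_ : OK → OK → OK
(a , b) ⊖ (c , d) = (a - c , b - d)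

_·_ : ℕ → OK → OK
n · (a , b) = (+ n * a , + n * b)

sumK : List OK → OK
sumK []       = (0ℤ , 0ℤ)
sumK (x ∷ xs) = x ⊕ sumK xs

-- "doubled coordinates": x + y ω_D = (A + B √D) / 2
dbl : ℕ → OK → ℤ × ℤ
dbl D (x , y) with D % 4
... | 1 = (+ 2 * x + y , y)            -- ω_D = (1 + √D)/2
... | _ = (+ 2 * x , + 2 * y)          -- ω_D = √D

-- A + B √D > 0 (real number, √D > 0, D not a square)
RealPos : ℕ → ℤ × ℤ → Set
RealPos D (A , B) =
    (0ℤ ≤ A × 0ℤ < B)
  ⊎ (0ℤ < A × 0ℤ ≤ B)
  ⊎ (0ℤ < A × B < 0ℤ × B * B * + D < A * A)
  ⊎ (A < 0ℤ × 0ℤ < B × A * A < B * B * + D)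

-- α totally positive: α > 0 and α' > 0, i.e. A > 0 and A² - B² D > 0
TotPos : ℕ → OK → Set
TotPos D α with dbl D α
... | (A , B) = 0ℤ < A × B * B * + D < A * A

_<[_]_ : OK → ℕ → OK → Set
α <[ D ] β = RealPos D (dbl D (β ⊖ α))

Indecomposable : ℕ → OK → Set
Indecomposable D α =
  TotPos D α × ¬ (Σ OK λ β → Σ OK λ γ → TotPos D β × TotPos D γ × α ≡ β ⊕ γ)

Consecutive : ℕ → OK → OK → Set
Consecutive D β γ =
  Indecomposable D β × Indecomposable D γ × β <[ D ] γ
  × (∀ δ → Indecomposable D δ → ¬ (β <[ D ] δ × δ <[ D ] γ))

IsRep : ℕ → OK → List OK → Set
IsRep D α L = L ≢ [] × All (TotPos D) L × sumK L ≡ α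

-- p_K(α) = n : there are exactly n unordered representations
-- (a list of n pairwise non-permutation-equivalent representations
--  such that every representation is a permutation of one of them)
PartCount : ℕ → OK → ℕ → Set
PartCount D α n =
  Σ (List (List OK)) λ Ls →
    length Ls ≡ n × All (IsRep D α) Ls × AllPairs (λ L M → ¬ (L ↭ M)) Ls
    × (∀ L → IsRep D α L → Any (L ↭_) Ls)

PartAtLeast : ℕ → OK → ℕ → Set
PartAtLeast D α n =
  Σ (List (List OK)) λ Ls →
    n ℕ.≤ length Ls × All (IsRep D α) Ls × AllPairs (λ L M → ¬ (L ↭ M)) Ls

{-# OPTIONS --safe #-}

-- Consecutive indecomposables β₀ < β₁ form a ℤ-basis of O_K: otherwise some γ = (r β₀ + s β₁) / N
-- with 0 ≤ r, s < N and (r , s) ≠ (0 , 0) is an algebraic integer, and an indecomposable summand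
-- of γ (or of β₀ + β₁ - γ) lies strictly between β₀ and β₁.  In the coordinates
-- (s , t) ↦ s β₀ + t β₁ the recurrences put β₋₁, β₂ and β₋₂ at (v₀ , -1), (-1 , v₁) and
-- (v₋₁ v₀ - 1 , -v₋₁).  Their indecomposability forces s + A t > 0 if t < 0 and t + B s > 0 if
-- s < 0 for every totally positive (s , t), whenever A < v₀ and B < v₁.  This confines the
-- summands of α = 2β₀ + β₁ = (2 , 1) to an explicit finite set; the partitions of α are then
-- listed, and the list is checked to be exhaustive, by evaluation.

module Submission where

open import Defs

-- The integer order opened in here must not be in scope at lemma7p6, whose statement uses the order on ℕ.
module _ where

  open import Data.Nat as ℕ using (ℕ; zero; suc; z≤n; s≤s)
  import Data.Nat.Properties as ℕ
  import Data.Nat.Divisibility as ℕ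
  open import Data.Nat.GCD using (GCD; gcd; gcd[m,n]∣m; gcd[m,n]∣n; gcd[m,n]≢0; gcd-GCD; GCD-*)
  open import Data.Nat.Coprimality as Coprime using (Coprime; GCD≡1⇒coprime; coprime-divisor)
  open import Data.Nat.Tactic.RingSolver using () renaming (solve-∀ to ℕ-solve-∀)
  open import Data.Integer using (ℤ; +_; -[1+_]; +[1+_]; 0ℤ; 1ℤ; -1ℤ; _+_; _-_; _*_; -_; ∣_∣; _<_; _≤_; +<+; +≤+; positive; nonNegative; ≢-nonZero)
  open import Data.Integer.Properties
  open import Algebra.Properties.CommutativeSemigroup +-commutativeSemigroup using (interchange)
  open import Data.Integer.DivMod using (_/_; _%_; a≡a%n+[a/n]*n; n%d<d)
  open import Data.Integer.Divisibility.Signed using (_∣_; divides; ∣-trans; *-monoʳ-∣; *-monoˡ-∣; *-cancelˡ-∣; ∣m∣n⇒∣m-n; ∣⇒∣ᵤ)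
  open import Data.Integer.Tactic.RingSolver using (solve-∀; solve)
  open import Data.List using (List; []; _∷_; _++_; length; map; concatMap; cartesianProduct)
  import Data.List.Properties as List
  open import Data.List.Membership.Propositional using (_∈_)
  open import Data.List.Membership.Propositional.Properties using (∈-map⁺; ∈-concat⁺′; ∈-cartesianProduct⁺)
  open import Data.List.Relation.Unary.All as All using (All; all?)
  import Data.List.Relation.Unary.All.Properties as All
  open import Data.List.Relation.Unary.Any as Any using (Any; here; there; any?)
  import Data.List.Relation.Unary.Any.Properties as Any
  open import Data.List.Relation.Unary.AllPairs as AllPairs using (AllPairs; allPairs?)
  import Data.List.Relation.Unary.AllPairs.Properties as AllPairs
  open import Data.List.Relation.Binary.Permutation.Propositional using (_↭_; ↭-sym; ↭-trans; ↭⇒↭ₛ′)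
  import Data.List.Relation.Binary.Permutation.Propositional.Properties as Perm
  open import Data.List.Relation.Binary.Pointwise as Pointwise using (Pointwise-≡⇒≡)
  open import Data.List.Relation.Unary.Sorted.TotalOrder.Properties using (↗↭↗⇒≋)
  import Data.List.Sort.InsertionSort.Base as InsertionSort
  import Data.List.Sort.InsertionSort.Properties as InsertionSortProperties
  open import Data.Product using (Σ; _×_; _,_; proj₁; proj₂; swap)
  open import Data.Product.Properties using (≡-dec)
  open import Data.Product.Relation.Binary.Lex.NonStrict using (×-decTotalOrder)
  open import Data.Product.Relation.Binary.Pointwise.NonDependent using (≡×≡⇒≡)
  open import Data.Sum using (_⊎_; inj₁; inj₂; map₂)
  open import Data.Empty using (⊥; ⊥-elim)
  open import Function using (_∘_)
  open import Relation.Binary.Bundles using (DecTotalOrder)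
  open import Relation.Binary.Definitions using (DecidableEquality; tri<; tri≈; tri>)
  open import Relation.Binary.PropositionalEquality
  open import Relation.Nullary using (¬_; Dec; yes; no; ¬?; _×-dec_; _→-dec_; _⊎-dec_)
  open import Relation.Nullary.Decidable using (map′; True; toWitness)

  pos*pos : ∀ {i j} → 0ℤ < i → 0ℤ < j → 0ℤ < i * j
  pos*pos {j = j} 0<i 0<j = *-monoʳ-<-pos j {{positive 0<j}} 0<i

  nonneg*nonneg : ∀ {i j} → 0ℤ ≤ i → 0ℤ ≤ j → 0ℤ ≤ i * j
  nonneg*nonneg {j = j} 0≤i 0≤j = *-monoʳ-≤-nonNeg j {{nonNegative 0≤j}} 0≤i

  i<j⇒0<j-i : ∀ {i j} → i < j → 0ℤ < j - i
  i<j⇒0<j-i {i} {j} i<j = subst (_< j - i) (+-inverseʳ i) (+-monoˡ-< (- i) i<j)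

  0<j-i⇒i<j : ∀ {i j} → 0ℤ < j - i → i < j
  0<j-i⇒i<j {i} {j} 0<j-i = subst₂ _<_ (+-identityˡ i) j-i+i≡j (+-monoˡ-< i 0<j-i)
    where j-i+i≡j : j - i + i ≡ j
          j-i+i≡j = solve (i ∷ j ∷ [])

  <-by-difference : ∀ {i j} e → j - i ≡ e → 0ℤ < e → i < j
  <-by-difference e refl = 0<j-i⇒i<j

  ≤-by-difference : ∀ {i j} e → j - i ≡ e → 0ℤ ≤ e → i ≤ j
  ≤-by-difference e refl = 0≤i-j⇒j≤i

  by-hypothesis : ∀ {e f t u} → u ≡ t → e ≡ f + (t - u) → e ≡ f
  by-hypothesis {f = f} {t} refl e≡f+[t-t] = trans e≡f+[t-t] (trans (cong (λ z → f + z) (+-inverseʳ t)) (+-identityʳ f))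

  square-nonneg : ∀ i → 0ℤ ≤ i * i
  square-nonneg (+ n)    = nonneg*nonneg {+ n} {+ n} (+≤+ z≤n) (+≤+ z≤n)
  square-nonneg -[1+ n ] = +≤+ z≤n

  square-pos : ∀ {i} → i ≢ 0ℤ → 0ℤ < i * i
  square-pos {+ zero}   i≢0 = ⊥-elim (i≢0 refl)
  square-pos {+[1+ n ]} _   = +<+ (s≤s z≤n)
  square-pos { -[1+ n ]} _  = +<+ (s≤s z≤n)

  square-mono-< : ∀ {i j} → 0ℤ ≤ i → i < j → i * i < j * j
  square-mono-< {i} {j} 0≤i i<j = <-by-difference ((j - i) * (j + i)) (solve (i ∷ j ∷ []))
    (pos*pos (i<j⇒0<j-i i<j) (+-mono-<-≤ (≤-<-trans 0≤i i<j) 0≤i))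

  square-cancel-< : ∀ {i j} → 0ℤ ≤ j → i * i < j * j → i < j
  square-cancel-< {i} {j} 0≤j i²<j² with <-cmp i j
  ... | tri< i<j _ _ = i<j
  ... | tri≈ _ refl _ = ⊥-elim (<-irrefl refl i²<j²)
  ... | tri> _ _ j<i = ⊥-elim (<-asym i²<j² (square-mono-< 0≤j j<i))

  neg*neg : ∀ i j → - i * - j ≡ i * j
  neg*neg = solve-∀

  square-* : ∀ i j → (i * i) * (j * j) ≡ (i * j) * (i * j)
  square-* = solve-∀

  *-mono-< : ∀ {i j k l} → 0ℤ ≤ i → i < j → 0ℤ ≤ k → k < l → i * k < j * l
  *-mono-< {i} {j} {k} {l} 0≤i i<j 0≤k k<l =
    <-by-difference ((j - i) * l + i * (l - k)) (solve (i ∷ j ∷ k ∷ l ∷ []))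
      (+-mono-<-≤ (pos*pos (i<j⇒0<j-i i<j) (≤-<-trans 0≤k k<l)) (nonneg*nonneg 0≤i (<⇒≤ (i<j⇒0<j-i k<l))))

  ∣i∣≡1⇒i*i≡1 : ∀ i → ∣ i ∣ ≡ 1 → i * i ≡ 1ℤ
  ∣i∣≡1⇒i*i≡1 (+ _)    refl = refl
  ∣i∣≡1⇒i*i≡1 -[1+ _ ] refl = refl

  0K : OK
  0K = 0ℤ , 0ℤ

  negK : OK → OK
  negK (a , b) = - a , - b

  infix 30 _⋆_
  _⋆_ : ℤ → OK → OK
  k ⋆ (a , b) = k * a , k * b

  ⊕-comm : ∀ x y → x ⊕ y ≡ y ⊕ x
  ⊕-comm (a , b) (c , d) = cong₂ _,_ (+-comm a c) (+-comm b d)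

  ⊕-identityʳ : ∀ x → x ⊕ 0K ≡ x
  ⊕-identityʳ (a , b) = cong₂ _,_ (+-identityʳ a) (+-identityʳ b)

  ⊕-identityˡ : ∀ x → 0K ⊕ x ≡ x
  ⊕-identityˡ (a , b) = cong₂ _,_ (+-identityˡ a) (+-identityˡ b)

  ⋆-identityˡ : ∀ x → 1ℤ ⋆ x ≡ x
  ⋆-identityˡ (a , b) = cong₂ _,_ (*-identityˡ a) (*-identityˡ b)

  ⋆-suc : ∀ n x → (+ suc n) ⋆ x ≡ x ⊕ (+ n) ⋆ x
  ⋆-suc n (a , b) = cong₂ _,_ (suc-* (+ n) a) (suc-* (+ n) b)

  ⋆-0K : ∀ k → k ⋆ 0K ≡ 0K
  ⋆-0K k = cong₂ _,_ (*-zeroʳ k) (*-zeroʳ k)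

  neg-⋆ : ∀ k x → negK (k ⋆ x) ≡ (- k) ⋆ x
  neg-⋆ k (a , b) = cong₂ _,_ (neg-distribˡ-* k a) (neg-distribˡ-* k b)

  ⋆-neg : ∀ k x → k ⋆ negK x ≡ negK (k ⋆ x)
  ⋆-neg k (a , b) = cong₂ _,_ (sym (neg-distribʳ-* k a)) (sym (neg-distribʳ-* k b))

  neg-⊕ : ∀ x y → negK (x ⊕ y) ≡ negK x ⊕ negK y
  neg-⊕ (a , b) (c , d) = cong₂ _,_ (neg-distrib-+ a c) (neg-distrib-+ b d)

  abs-⋆ : ∀ N x → Σ OK λ x′ → (+ ∣ N ∣) ⋆ x′ ≡ N ⋆ x
  abs-⋆ N x with +∣i∣≡i⊎+∣i∣≡-i N
  ... | inj₁ ∣N∣≡N  = x , cong (_⋆ x) ∣N∣≡N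
  ... | inj₂ ∣N∣≡-N = negK x , trans (cong (_⋆ negK x) ∣N∣≡-N) (cong₂ _,_ (neg*neg N (proj₁ x)) (neg*neg N (proj₂ x)))

  ⊖-self : ∀ x → x ⊖ x ≡ 0K
  ⊖-self (a , b) = cong₂ _,_ (+-inverseʳ a) (+-inverseʳ b)

  ⊖-telescope : ∀ x y z → (x ⊖ y) ⊕ (y ⊖ z) ≡ x ⊖ z
  ⊖-telescope (a , b) (c , d) (e , f) = cong₂ _,_ (telescope a c e) (telescope b d f)
    where telescope : ∀ i j k → (i - j) + (j - k) ≡ i - k
          telescope = solve-∀

  neg-⊖ : ∀ x y → negK (x ⊖ y) ≡ y ⊖ x
  neg-⊖ (a , b) (c , d) = cong₂ _,_ (neg-minus a c) (neg-minus b d)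
    where neg-minus : ∀ i j → - (i - j) ≡ j - i
          neg-minus = solve-∀

  ⊕-⊖-cancel : ∀ x y → x ⊕ (y ⊖ x) ≡ y
  ⊕-⊖-cancel (a , b) (c , d) = cong₂ _,_ (cancel a c) (cancel b d)
    where cancel : ∀ i j → i + (j - i) ≡ j
          cancel = solve-∀

  ⊕-⊖-cancelˡ : ∀ x y → (x ⊕ y) ⊖ x ≡ y
  ⊕-⊖-cancelˡ (a , b) (c , d) = cong₂ _,_ (cancel a c) (cancel b d)
    where cancel : ∀ i j → (i + j) - i ≡ j
          cancel = solve-∀

  ⊕-⊖-assoc : ∀ x y z → (x ⊕ y) ⊖ z ≡ x ⊕ (y ⊖ z)
  ⊕-⊖-assoc (a , b) (c , d) (e , f) = cong₂ _,_ (assoc a c e) (assoc b d f)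
    where assoc : ∀ i j k → (i + j) - k ≡ i + (j - k)
          assoc = solve-∀

  ⊕-⊖-comm : ∀ x y z → (x ⊕ y) ⊖ z ≡ (x ⊖ z) ⊕ y
  ⊕-⊖-comm (a , b) (c , d) (e , f) = cong₂ _,_ (rearrange a c e) (rearrange b d f)
    where rearrange : ∀ i j k → (i + j) - k ≡ (i - k) + j
          rearrange = solve-∀

  recurrence-left : ∀ v x y z → v · y ≡ x ⊕ z → x ≡ (+ v) ⋆ y ⊖ z
  recurrence-left v (a , b) y (c , d) eq =
    cong₂ _,_ (trans (sym (add-sub a c)) (cong (_- c) (sym (cong proj₁ eq))))
              (trans (sym (add-sub b d)) (cong (_- d) (sym (cong proj₂ eq))))
    where add-sub : ∀ i j → (i + j) - j ≡ i
          add-sub = solve-∀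

  det : OK → OK → ℤ
  det (a , b) (c , e) = a * e - b * c

  -- Cones in ℤ² and their indecomposables

  OrZero : (OK → Set) → OK → Set
  OrZero C x = x ≡ 0K ⊎ C x

  ⊕-closed⇒⋆-closed : ∀ {C : OK → Set} → (∀ {x y} → C x → C y → C (x ⊕ y)) →
                  ∀ {k x} → 0ℤ < k → C x → C (k ⋆ x)
  ⊕-closed⇒⋆-closed {C} ⊕-closed {+[1+ n ]} {x} _ = go n
    where
      go : ∀ n → C x → C ((+ suc n) ⋆ x)
      go zero    Cx = subst C (sym (⋆-identityˡ x)) Cx
      go (suc n) Cx = subst C (sym (⋆-suc (suc n) x)) (⊕-closed Cx (go n Cx))
  ⊕-closed⇒⋆-closed _ {+ zero} (+<+ ())

  record IsCone (C : OK → Set) : Set where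
    field
      ⊕-closed : ∀ {x y} → C x → C y → C (x ⊕ y)
      ⋆-cancel : ∀ {k x} → 0ℤ < k → C (k ⋆ x) → C x
      0∉       : ¬ C 0K

    ⋆-closed : ∀ {k x} → 0ℤ < k → C x → C (k ⋆ x)
    ⋆-closed = ⊕-closed⇒⋆-closed {C} ⊕-closed

    ⊕-closed₀ : ∀ {x y} → C x → OrZero C y → C (x ⊕ y)
    ⊕-closed₀ {x} Cx (inj₁ refl) = subst C (sym (⊕-identityʳ x)) Cx
    ⊕-closed₀     Cx (inj₂ Cy)   = ⊕-closed Cx Cy

    ₀⊕-closed : ∀ {x y} → OrZero C x → C y → C (x ⊕ y)
    ₀⊕-closed {x} {y} C₀x Cy = subst C (⊕-comm y x) (⊕-closed₀ Cy C₀x)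

    ₀⊕₀-closed : ∀ {x y} → OrZero C x → OrZero C y → OrZero C (x ⊕ y)
    ₀⊕₀-closed {y = y} (inj₁ refl) C₀y = subst (OrZero C) (sym (⊕-identityˡ y)) C₀y
    ₀⊕₀-closed         (inj₂ Cx)   C₀y = inj₂ (⊕-closed₀ Cx C₀y)

    ⋆-closed₀ : ∀ {k x} → 0ℤ ≤ k → C x → OrZero C (k ⋆ x)
    ⋆-closed₀ {+ zero}   _ _  = inj₁ refl
    ⋆-closed₀ {+[1+ n ]} _ Cx = inj₂ (⋆-closed {+[1+ n ]} (+<+ (s≤s z≤n)) Cx)

    ⋆⊕⋆-closed : ∀ {r s x y} → 0ℤ ≤ r → 0ℤ ≤ s → 0ℤ < r + s → C x → C y → C (r ⋆ x ⊕ s ⋆ y)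
    ⋆⊕⋆-closed {+ zero}   {s} _ _ 0<0+s _ Cy = ₀⊕-closed (inj₁ refl) (⋆-closed (subst (0ℤ <_) (+-identityˡ s) 0<0+s) Cy)
    ⋆⊕⋆-closed {+[1+ n ]} _ 0≤s _ Cx Cy = ⊕-closed₀ (⋆-closed {+[1+ n ]} (+<+ (s≤s z≤n)) Cx) (⋆-closed₀ 0≤s Cy)

  isCone-resp : ∀ {C C′} → (∀ {x} → C x → C′ x) → (∀ {x} → C′ x → C x) → IsCone C → IsCone C′
  isCone-resp to from cone = record
    { ⊕-closed = λ {x} {y} C′x C′y → to {x ⊕ y} (⊕-closed (from {x} C′x) (from {y} C′y))
    ; ⋆-cancel = λ {k} {x} 0<k C′kx → to {x} (⋆-cancel 0<k (from {k ⋆ x} C′kx))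
    ; 0∉       = λ C′0 → 0∉ (from {0K} C′0)
    }
    where open IsCone cone

  isCone-pullback : ∀ {C : OK → Set} {f : OK → OK} → (∀ x y → f (x ⊕ y) ≡ f x ⊕ f y) → (∀ k x → f (k ⋆ x) ≡ k ⋆ f x) →
                    IsCone C → IsCone (λ x → C (f x))
  isCone-pullback {C} {f} f-⊕ f-⋆ cone = record
    { ⊕-closed = λ {x} {y} Cfx Cfy → subst C (sym (f-⊕ x y)) (⊕-closed Cfx Cfy)
    ; ⋆-cancel = λ {k} {x} 0<k Cfkx → ⋆-cancel {k} {f x} 0<k (subst C (f-⋆ k x) Cfkx)
    ; 0∉       = λ Cf0 → 0∉ (subst C (trans (f-⋆ 0ℤ 0K) (⋆-0K 0ℤ)) Cf0)
    }
    where open IsCone cone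

  _∩_ : (OK → Set) → (OK → Set) → OK → Set
  (C ∩ C′) x = C x × C′ x

  ∩-isCone : ∀ {C C′} → IsCone C → IsCone C′ → IsCone (C ∩ C′)
  ∩-isCone cone cone′ = record
    { ⊕-closed = λ (Cx , C′x) (Cy , C′y) → C.⊕-closed Cx Cy , C′.⊕-closed C′x C′y
    ; ⋆-cancel = λ 0<k (Ckx , C′kx) → C.⋆-cancel 0<k Ckx , C′.⋆-cancel 0<k C′kx
    ; 0∉       = λ (C0 , _) → C.0∉ C0
    }
    where
      module C = IsCone cone
      module C′ = IsCone cone′

  record IsPositiveCone (P : OK → Set) : Set where
    field
      ⊕-closed : ∀ {x y} → P x → P y → P (x ⊕ y)
      total    : ∀ {x} → x ≢ 0K → P x ⊎ P (negK x)
      asym     : ∀ {x} → P x → ¬ P (negK x)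

    ⋆-cancel : ∀ {k x} → 0ℤ < k → P (k ⋆ x) → P x
    ⋆-cancel {k} {x} 0<k Pkx with total {x} (λ { refl → let P0 = subst P (⋆-0K k) Pkx in asym P0 P0 })
    ... | inj₁ Px  = Px
    ... | inj₂ P-x = ⊥-elim (asym Pkx (subst P (⋆-neg k x) (⊕-closed⇒⋆-closed {P} ⊕-closed 0<k P-x)))

    isCone : IsCone P
    isCone = record { ⊕-closed = ⊕-closed ; ⋆-cancel = ⋆-cancel ; 0∉ = λ P0 → asym P0 P0 }

    open IsCone isCone public using (⋆-closed; ⊕-closed₀; ₀⊕-closed; ⋆-closed₀; ⋆⊕⋆-closed; 0∉)

    ⋆-sign : ∀ {k x} → P x → P (k ⋆ x) → 0ℤ < k
    ⋆-sign {k} {x} Px Pkx with <-cmp 0ℤ k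
    ... | tri< 0<k _ _ = 0<k
    ... | tri≈ _ refl _ = ⊥-elim (0∉ Pkx)
    ... | tri> _ _ k<0 = ⊥-elim (asym Pkx (subst P (sym (neg-⋆ k x)) (⋆-closed (neg-mono-< k<0) Px)))

  record IsLinearInjection (f : OK → OK) : Set where
    field
      ⊕-hom     : ∀ x y → f (x ⊕ y) ≡ f x ⊕ f y
      neg-hom   : ∀ x → f (negK x) ≡ negK (f x)
      injective : ∀ {x} → f x ≡ 0K → x ≡ 0K

  ∘-isLinearInjection : ∀ {f g} → IsLinearInjection f → IsLinearInjection g → IsLinearInjection (λ x → g (f x))
  ∘-isLinearInjection {f} {g} F G = record
    { ⊕-hom     = λ x y → trans (cong g (F.⊕-hom x y)) (G.⊕-hom (f x) (f y))
    ; neg-hom   = λ x → trans (cong g (F.neg-hom x)) (G.neg-hom (f x))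
    ; injective = λ gfx≡0 → F.injective (G.injective gfx≡0)
    }
    where
      module F = IsLinearInjection F
      module G = IsLinearInjection G

  isPositiveCone-pullback : ∀ {f P} → IsLinearInjection f → IsPositiveCone P → IsPositiveCone (λ x → P (f x))
  isPositiveCone-pullback {f} {P} F cone = record
    { ⊕-closed = λ {x} {y} Pfx Pfy → subst P (sym (F.⊕-hom x y)) (⊕-closed Pfx Pfy)
    ; total    = λ {x} x≢0 → map₂ (subst P (sym (F.neg-hom x))) (total (λ fx≡0 → x≢0 (F.injective fx≡0)))
    ; asym     = λ {x} Pfx Pf-x → asym Pfx (subst P (F.neg-hom x) Pf-x)
    }
    where module F = IsLinearInjection F
          open IsPositiveCone cone

  IndecomposableIn : (OK → Set) → OK → Set
  IndecomposableIn C α = C α × ¬ (Σ OK λ β → Σ OK λ γ → C β × C γ × α ≡ β ⊕ γ)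

  indecomposableIn-resp : ∀ {C C′} → (∀ {x} → C x → C′ x) → (∀ {x} → C′ x → C x) →
                          ∀ {b} → IndecomposableIn C b → IndecomposableIn C′ b
  indecomposableIn-resp to from (Cb , b-indec) =
    to Cb , λ (β , γ , C′β , C′γ , b≡β⊕γ) → b-indec (β , γ , from C′β , from C′γ , b≡β⊕γ)

  indecomposable-order-flip : ∀ {P P′} → IsPositiveCone P → IsPositiveCone P′ →
    ∀ {b δ} → IndecomposableIn (P ∩ P′) b → (P ∩ P′) δ → P′ (b ⊖ δ) → P (δ ⊖ b)
  indecomposable-order-flip {P} {P′} pos pos′ {b} {δ} (_ , b-indec) Cδ P′b-δ
    with IsPositiveCone.total pos {δ ⊖ b} (λ δ-b≡0 → IsPositiveCone.0∉ pos′ (subst P′ (trans (sym (neg-⊖ δ b)) (cong negK δ-b≡0)) P′b-δ))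
  ... | inj₁ Pδ-b  = Pδ-b
  ... | inj₂ Pb-δ = ⊥-elim (b-indec (δ , b ⊖ δ , Cδ , (subst P (neg-⊖ δ b) Pb-δ , P′b-δ) , sym (⊕-⊖-cancel δ b)))

  indecomposable-pullback : ∀ {C : OK → Set} {f : OK → OK} → (∀ x y → f (x ⊕ y) ≡ f x ⊕ f y) →
                            ∀ {x} → IndecomposableIn C (f x) → IndecomposableIn (λ z → C (f z)) x
  indecomposable-pullback {f = f} f-⊕ (Cfx , fx-indec) =
    Cfx , λ (β , γ , Cfβ , Cfγ , x≡β⊕γ) → fx-indec (f β , f γ , Cfβ , Cfγ , trans (cong f x≡β⊕γ) (f-⊕ β γ))

  -- Total positivity in ℚ(√D)

  squarefree⇒m²≢n²D : ∀ {D} → Squarefree D → 2 ℕ.≤ D → ∀ m n → n ≢ 0 → m ℕ.* m ≢ n ℕ.* n ℕ.* D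
  squarefree⇒m²≢n²D {D} sf 2≤D m n n≢0 m²≡n²D = ℕ.<⇒≢ 2≤D (sym D≡1)
    where
      g = gcd m n
      instance
        g≢0 : ℕ.NonZero g
        g≢0 = ℕ.≢-nonZero (gcd[m,n]≢0 m n (inj₂ n≢0))
        g²≢0 : ℕ.NonZero (g ℕ.* g)
        g²≢0 = ℕ.m*n≢0 g g
      m′ = ℕ.quotient (gcd[m,n]∣m m n)
      n′ = ℕ.quotient (gcd[m,n]∣n m n)
      m≡m′g : m ≡ m′ ℕ.* g
      m≡m′g = ℕ._∣_.equality (gcd[m,n]∣m m n)
      n≡n′g : n ≡ n′ ℕ.* g
      n≡n′g = ℕ._∣_.equality (gcd[m,n]∣n m n)
      n′⊥m′ : Coprime n′ m′
      n′⊥m′ = Coprime.sym (GCD≡1⇒coprime (GCD-* (subst₂ (λ i j → GCD i j (1 ℕ.* g)) m≡m′g n≡n′g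
                (subst (GCD m n) (sym (ℕ.*-identityˡ g)) (gcd-GCD m n)))))
      m′²≡n′²D : m′ ℕ.* m′ ≡ n′ ℕ.* n′ ℕ.* D
      m′²≡n′²D = ℕ.*-cancelʳ-≡ _ _ (g ℕ.* g) (begin
        m′ ℕ.* m′ ℕ.* (g ℕ.* g)          ≡⟨ ℕ-solve m′ g ⟩
        (m′ ℕ.* g) ℕ.* (m′ ℕ.* g)        ≡⟨ cong (λ i → i ℕ.* i) (sym m≡m′g) ⟩
        m ℕ.* m                          ≡⟨ m²≡n²D ⟩
        n ℕ.* n ℕ.* D                    ≡⟨ cong (λ i → i ℕ.* i ℕ.* D) n≡n′g ⟩
        (n′ ℕ.* g) ℕ.* (n′ ℕ.* g) ℕ.* D  ≡⟨ ℕ-solve′ n′ g D ⟩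
        n′ ℕ.* n′ ℕ.* D ℕ.* (g ℕ.* g)    ∎)
        where
          open ≡-Reasoning
          ℕ-solve : ∀ a b → a ℕ.* a ℕ.* (b ℕ.* b) ≡ (a ℕ.* b) ℕ.* (a ℕ.* b)
          ℕ-solve = ℕ-solve-∀
          ℕ-solve′ : ∀ a b c → (a ℕ.* b) ℕ.* (a ℕ.* b) ℕ.* c ≡ a ℕ.* a ℕ.* c ℕ.* (b ℕ.* b)
          ℕ-solve′ = ℕ-solve-∀
      n′≡1 : n′ ≡ 1
      n′≡1 = n′⊥m′ (ℕ.∣-refl , coprime-divisor n′⊥m′ (ℕ.divides (n′ ℕ.* D) (trans m′²≡n′²D (ℕ-solve n′ D))))
        where
          ℕ-solve : ∀ a b → a ℕ.* a ℕ.* b ≡ (a ℕ.* b) ℕ.* a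
          ℕ-solve = ℕ-solve-∀
      m′²≡D : m′ ℕ.* m′ ≡ D
      m′²≡D = trans m′²≡n′²D (trans (cong (λ i → i ℕ.* i ℕ.* D) n′≡1) (ℕ.+-identityʳ D))
      D≡1 : D ≡ 1
      D≡1 = trans (sym m′²≡D) (cong (λ i → i ℕ.* i) (sf m′ (ℕ.divides 1 (sym (trans (ℕ.*-identityˡ _) m′²≡D)))))

  squarefree⇒i²≢j²D : ∀ {D} → Squarefree D → 2 ℕ.≤ D → ∀ i j → j ≢ 0ℤ → i * i ≢ j * j * + D
  squarefree⇒i²≢j²D {D} sf 2≤D i j j≢0 i²≡j²D =
    squarefree⇒m²≢n²D sf 2≤D ∣ i ∣ ∣ j ∣ (λ ∣j∣≡0 → j≢0 (∣i∣≡0⇒i≡0 ∣j∣≡0))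
      (trans (sym (abs-* i i)) (trans (cong ∣_∣ i²≡j²D) (trans (abs-* (j * j) (+ D)) (cong (ℕ._* D) (abs-* j j)))))

  data RealPosView (D : ℕ) (A B : ℤ) : Set where
    nonneg       : 0ℤ ≤ A → 0ℤ ≤ B → 0ℤ < A + B → RealPosView D A B
    rational-dom : 0ℤ < A → B < 0ℤ → B * B * + D < A * A → RealPosView D A B
    surd-dom     : A < 0ℤ → 0ℤ < B → A * A < B * B * + D → RealPosView D A B

  module _ {D : ℕ} where

    view : ∀ {A B} → RealPos D (A , B) → RealPosView D A B
    view (inj₁ (0≤A , 0<B))                 = nonneg 0≤A (<⇒≤ 0<B) (+-mono-≤-< 0≤A 0<B)
    view (inj₂ (inj₁ (0<A , 0≤B)))          = nonneg (<⇒≤ 0<A) 0≤B (+-mono-<-≤ 0<A 0≤B)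
    view (inj₂ (inj₂ (inj₁ (0<A , B<0 , q)))) = rational-dom 0<A B<0 q
    view (inj₂ (inj₂ (inj₂ (A<0 , 0<B , q)))) = surd-dom A<0 0<B q

    nonneg⇒RealPos : ∀ {A B} → 0ℤ ≤ A → 0ℤ ≤ B → 0ℤ < A + B → RealPos D (A , B)
    nonneg⇒RealPos {+ zero}   {B} _ _ 0<B = inj₁ (+≤+ z≤n , subst (0ℤ <_) (+-identityˡ B) 0<B)
    nonneg⇒RealPos {+[1+ n ]}     _ 0≤B _ = inj₂ (inj₁ (+<+ (s≤s z≤n) , 0≤B))

    private
      ≥0⊎<0 : ∀ i → 0ℤ ≤ i ⊎ i < 0ℤ
      ≥0⊎<0 i with <-cmp i 0ℤ
      ... | tri< i<0 _ _ = inj₂ i<0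
      ... | tri≈ _ refl _ = inj₁ ≤-refl
      ... | tri> _ _ 0<i = inj₁ (<⇒≤ 0<i)

      0≤d : 0ℤ ≤ + D
      0≤d = +≤+ z≤n

    nonneg+rational-dom : ∀ {A₁ B₁ A₂ B₂} → 0ℤ ≤ A₁ → 0ℤ ≤ B₁ →
      0ℤ < A₂ → B₂ < 0ℤ → B₂ * B₂ * + D < A₂ * A₂ → RealPos D (A₁ + A₂ , B₁ + B₂)
    nonneg+rational-dom {A₁} {B₁} {A₂} {B₂} 0≤A₁ 0≤B₁ 0<A₂ B₂<0 q₂ with ≥0⊎<0 (B₁ + B₂)
    ... | inj₁ 0≤B = inj₂ (inj₁ (+-mono-≤-< 0≤A₁ 0<A₂ , 0≤B))
    ... | inj₂ B<0 = inj₂ (inj₂ (inj₁ (+-mono-≤-< 0≤A₁ 0<A₂ , B<0 ,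
        <-by-difference _ (identity (+ D)) (+-mono-<-≤ (i<j⇒0<j-i q₂)
          (+-mono-≤ (nonneg*nonneg 0≤A₁ (+-mono-≤ 0≤A₁ (<⇒≤ (+-mono-< 0<A₂ 0<A₂))))
                    (nonneg*nonneg 0≤d (nonneg*nonneg 0≤B₁ (<⇒≤ (neg-mono-< (+-mono-< B<0 B₂<0))))))))))
      where
        identity : ∀ d → (A₁ + A₂) * (A₁ + A₂) - (B₁ + B₂) * (B₁ + B₂) * d
                         ≡ (A₂ * A₂ - B₂ * B₂ * d) + (A₁ * (A₁ + (A₂ + A₂)) + d * (B₁ * - (B₁ + B₂ + B₂)))
        identity d = solve (A₁ ∷ B₁ ∷ A₂ ∷ B₂ ∷ d ∷ [])

    nonneg+surd-dom : ∀ {A₁ B₁ A₂ B₂} → 0ℤ ≤ A₁ → 0ℤ ≤ B₁ →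
      A₂ < 0ℤ → 0ℤ < B₂ → A₂ * A₂ < B₂ * B₂ * + D → RealPos D (A₁ + A₂ , B₁ + B₂)
    nonneg+surd-dom {A₁} {B₁} {A₂} {B₂} 0≤A₁ 0≤B₁ A₂<0 0<B₂ q₂ with ≥0⊎<0 (A₁ + A₂)
    ... | inj₁ 0≤A = inj₁ (0≤A , +-mono-≤-< 0≤B₁ 0<B₂)
    ... | inj₂ A<0 = inj₂ (inj₂ (inj₂ (A<0 , +-mono-≤-< 0≤B₁ 0<B₂ ,
        <-by-difference _ (identity (+ D)) (+-mono-<-≤ (i<j⇒0<j-i q₂)
          (+-mono-≤ (nonneg*nonneg 0≤d (nonneg*nonneg 0≤B₁ (+-mono-≤ 0≤B₁ (<⇒≤ (+-mono-< 0<B₂ 0<B₂)))))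
                    (nonneg*nonneg 0≤A₁ (<⇒≤ (neg-mono-< (+-mono-< A<0 A₂<0)))))))))
      where
        identity : ∀ d → (B₁ + B₂) * (B₁ + B₂) * d - (A₁ + A₂) * (A₁ + A₂)
                         ≡ (B₂ * B₂ * d - A₂ * A₂) + (d * (B₁ * (B₁ + (B₂ + B₂))) + A₁ * - (A₁ + A₂ + A₂))
        identity d = solve (A₁ ∷ B₁ ∷ A₂ ∷ B₂ ∷ d ∷ [])

    rational-dom+rational-dom : ∀ {A₁ B₁ A₂ B₂} →
      0ℤ < A₁ → B₁ < 0ℤ → B₁ * B₁ * + D < A₁ * A₁ →
      0ℤ < A₂ → B₂ < 0ℤ → B₂ * B₂ * + D < A₂ * A₂ → RealPos D (A₁ + A₂ , B₁ + B₂)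
    rational-dom+rational-dom {A₁} {B₁} {A₂} {B₂} 0<A₁ B₁<0 q₁ 0<A₂ B₂<0 q₂ =
      inj₂ (inj₂ (inj₁ (+-mono-< 0<A₁ 0<A₂ , +-mono-< B₁<0 B₂<0 ,
        <-by-difference _ (identity (+ D))
          (+-mono-< (+-mono-< (i<j⇒0<j-i q₁) (i<j⇒0<j-i q₂)) (pos*pos {+ 2} (+<+ (s≤s z≤n)) (i<j⇒0<j-i cross))))))
      where
        identity : ∀ d → (A₁ + A₂) * (A₁ + A₂) - (B₁ + B₂) * (B₁ + B₂) * d
                         ≡ (A₁ * A₁ - B₁ * B₁ * d) + (A₂ * A₂ - B₂ * B₂ * d) + + 2 * (A₁ * A₂ - B₁ * B₂ * d)
        identity d = solve (A₁ ∷ B₁ ∷ A₂ ∷ B₂ ∷ d ∷ [])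
        cross : B₁ * B₂ * + D < A₁ * A₂
        cross = square-cancel-< (nonneg*nonneg (<⇒≤ 0<A₁) (<⇒≤ 0<A₂)) (subst₂ _<_ (square-product (+ D)) (square-* A₁ A₂)
          (*-mono-< (nonneg*nonneg (square-nonneg B₁) 0≤d) q₁ (nonneg*nonneg (square-nonneg B₂) 0≤d) q₂))
          where
            square-product : ∀ d → (B₁ * B₁ * d) * (B₂ * B₂ * d) ≡ (B₁ * B₂ * d) * (B₁ * B₂ * d)
            square-product d = solve (B₁ ∷ B₂ ∷ d ∷ [])

    surd-dom+surd-dom : ∀ {A₁ B₁ A₂ B₂} →
      A₁ < 0ℤ → 0ℤ < B₁ → A₁ * A₁ < B₁ * B₁ * + D →
      A₂ < 0ℤ → 0ℤ < B₂ → A₂ * A₂ < B₂ * B₂ * + D → RealPos D (A₁ + A₂ , B₁ + B₂)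
    surd-dom+surd-dom {A₁} {B₁} {A₂} {B₂} A₁<0 0<B₁ q₁ A₂<0 0<B₂ q₂ =
      inj₂ (inj₂ (inj₂ (+-mono-< A₁<0 A₂<0 , +-mono-< 0<B₁ 0<B₂ ,
        <-by-difference _ (identity (+ D))
          (+-mono-< (+-mono-< (i<j⇒0<j-i q₁) (i<j⇒0<j-i q₂)) (pos*pos {+ 2} (+<+ (s≤s z≤n)) (i<j⇒0<j-i cross))))))
      where
        identity : ∀ d → (B₁ + B₂) * (B₁ + B₂) * d - (A₁ + A₂) * (A₁ + A₂)
                         ≡ (B₁ * B₁ * d - A₁ * A₁) + (B₂ * B₂ * d - A₂ * A₂) + + 2 * (B₁ * B₂ * d - A₁ * A₂)
        identity d = solve (A₁ ∷ B₁ ∷ A₂ ∷ B₂ ∷ d ∷ [])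
        cross : A₁ * A₂ < B₁ * B₂ * + D
        cross = square-cancel-< (nonneg*nonneg (nonneg*nonneg (<⇒≤ 0<B₁) (<⇒≤ 0<B₂)) 0≤d)
          (subst₂ _<_ (square-* A₁ A₂) (square-product (+ D))
            (*-mono-< (square-nonneg A₁) q₁ (square-nonneg A₂) q₂))
          where
            square-product : ∀ d → (B₁ * B₁ * d) * (B₂ * B₂ * d) ≡ (B₁ * B₂ * d) * (B₁ * B₂ * d)
            square-product d = solve (B₁ ∷ B₂ ∷ d ∷ [])

    private
      open ≤-Reasoning

      swap-squares : ∀ b c d → b * b * d * (c * c) ≡ c * c * d * (- b * - b)
      swap-squares b c d = solve (b ∷ c ∷ d ∷ [])

      neg-square-* : ∀ a b → a * a * (b * b) ≡ (- a * b) * (- a * b)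
      neg-square-* a b = solve (a ∷ b ∷ [])

      neg-square-*′ : ∀ a b → (a * a) * (b * b) ≡ (a * - b) * (a * - b)
      neg-square-*′ a b = solve (a ∷ b ∷ [])

      regroup : ∀ a b d → (a * a) * (b * b * d) ≡ a * a * d * (b * b)
      regroup a b d = solve (a ∷ b ∷ d ∷ [])

      cross-identity₁ : ∀ a₁ b₁ a₂ b₂ → (a₁ + a₂) * - b₁ - a₁ * - (b₁ + b₂) ≡ a₁ * b₂ - a₂ * b₁
      cross-identity₁ = solve-∀

      cross-identity₂ : ∀ a₁ b₁ a₂ b₂ → (b₁ + b₂) * - a₂ - - (a₁ + a₂) * b₂ ≡ a₁ * b₂ - a₂ * b₁
      cross-identity₂ = solve-∀

      cross-identity₃ : ∀ a₁ b₁ a₂ b₂ → a₁ * b₂ - a₂ * b₁ ≡ (b₁ + b₂) * a₁ - (a₁ + a₂) * b₁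
      cross-identity₃ = solve-∀

      cross-term : ∀ {A₁ B₁ A₂ B₂} → 0ℤ < A₁ → B₁ < 0ℤ → B₁ * B₁ * + D < A₁ * A₁ →
                   0ℤ < B₂ → A₂ * A₂ < B₂ * B₂ * + D → A₂ * B₁ < A₁ * B₂
      cross-term {A₁} {B₁} {A₂} {B₂} 0<A₁ B₁<0 q₁ 0<B₂ q₂ =
        square-cancel-< (nonneg*nonneg (<⇒≤ 0<A₁) (<⇒≤ 0<B₂)) (begin-strict
          (A₂ * B₁) * (A₂ * B₁)       ≡⟨ square-* A₂ B₁ ⟨
          (A₂ * A₂) * (B₁ * B₁)       <⟨ *-monoʳ-<-pos (B₁ * B₁) {{positive (square-pos (<⇒≢ B₁<0))}} q₂ ⟩
          (B₂ * B₂ * + D) * (B₁ * B₁) ≡⟨ regroup′ B₂ B₁ (+ D) ⟩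
          (B₁ * B₁ * + D) * (B₂ * B₂) <⟨ *-monoʳ-<-pos (B₂ * B₂) {{positive (square-pos (≢-sym (<⇒≢ 0<B₂)))}} q₁ ⟩
          (A₁ * A₁) * (B₂ * B₂)       ≡⟨ square-* A₁ B₂ ⟩
          (A₁ * B₂) * (A₁ * B₂)       ∎)
        where
          regroup′ : ∀ a b d → (a * a * d) * (b * b) ≡ (b * b * d) * (a * a)
          regroup′ a b d = solve (a ∷ b ∷ d ∷ [])

    rational-dom+surd-dom : ∀ {A₁ B₁ A₂ B₂} →
      0ℤ < A₁ → B₁ < 0ℤ → B₁ * B₁ * + D < A₁ * A₁ →
      A₂ < 0ℤ → 0ℤ < B₂ → A₂ * A₂ < B₂ * B₂ * + D → RealPos D (A₁ + A₂ , B₁ + B₂)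
    rational-dom+surd-dom {A₁} {B₁} {A₂} {B₂} 0<A₁ B₁<0 q₁ A₂<0 0<B₂ q₂
      with ≥0⊎<0 (B₁ + B₂) | <-cmp 0ℤ (A₁ + A₂) | cross-term {A₁} {B₁} {A₂} {B₂} 0<A₁ B₁<0 q₁ 0<B₂ q₂
    ... | inj₂ B<0 | _ | cross = inj₂ (inj₂ (inj₁ (0<A , B<0 , *-cancelʳ-<-nonNeg (B₁ * B₁) {{nonNegative (square-nonneg B₁)}} (begin-strict
        B * B * + D * (B₁ * B₁)      ≡⟨ swap-squares B B₁ (+ D) ⟩
        B₁ * B₁ * + D * (- B * - B)  <⟨ *-monoʳ-<-pos (- B * - B) {{positive (square-pos -B≢0)}} q₁ ⟩
        A₁ * A₁ * (- B * - B)        ≡⟨ square-* A₁ (- B) ⟩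
        (A₁ * - B) * (A₁ * - B)      <⟨ square-mono-< (<⇒≤ 0<A₁-B) A₁-B<A-B₁ ⟩
        (A * - B₁) * (A * - B₁)      ≡⟨ sym (neg-square-*′ A B₁) ⟩
        A * A * (B₁ * B₁)            ∎))))
      where
        A = A₁ + A₂
        B = B₁ + B₂
        A₁-B<A-B₁ : A₁ * - B < A * - B₁
        A₁-B<A-B₁ = <-by-difference (A₁ * B₂ - A₂ * B₁) (cross-identity₁ A₁ B₁ A₂ B₂) (i<j⇒0<j-i cross)
        0<A₁-B : 0ℤ < A₁ * - B
        0<A₁-B = pos*pos 0<A₁ (neg-mono-< B<0)
        -B≢0 : - B ≢ 0ℤ
        -B≢0 = ≢-sym (<⇒≢ (neg-mono-< B<0))
        0<A : 0ℤ < A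
        0<A = *-cancelʳ-<-nonNeg (- B₁) {{nonNegative (<⇒≤ (neg-mono-< B₁<0))}} (<-trans 0<A₁-B A₁-B<A-B₁)
    ... | inj₁ 0≤B | tri> _ _ A<0 | cross = inj₂ (inj₂ (inj₂ (A<0 , 0<B , *-cancelʳ-<-nonNeg (B₂ * B₂) {{nonNegative (square-nonneg B₂)}} (begin-strict
        A * A * (B₂ * B₂)            ≡⟨ neg-square-* A B₂ ⟩
        (- A * B₂) * (- A * B₂)      <⟨ square-mono-< (<⇒≤ 0<-AB₂) -AB₂<B-A₂ ⟩
        (B * - A₂) * (B * - A₂)      ≡⟨ sym (neg-square-*′ B A₂) ⟩
        (B * B) * (A₂ * A₂)          <⟨ *-monoˡ-<-pos (B * B) {{positive (square-pos B≢0)}} q₂ ⟩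
        (B * B) * (B₂ * B₂ * + D)    ≡⟨ regroup B B₂ (+ D) ⟩
        B * B * + D * (B₂ * B₂)      ∎))))
      where
        A = A₁ + A₂
        B = B₁ + B₂
        -AB₂<B-A₂ : - A * B₂ < B * - A₂
        -AB₂<B-A₂ = <-by-difference (A₁ * B₂ - A₂ * B₁) (cross-identity₂ A₁ B₁ A₂ B₂) (i<j⇒0<j-i cross)
        0<-AB₂ : 0ℤ < - A * B₂
        0<-AB₂ = pos*pos (neg-mono-< A<0) 0<B₂
        0<B : 0ℤ < B
        0<B = *-cancelʳ-<-nonNeg (- A₂) {{nonNegative (<⇒≤ (neg-mono-< A₂<0))}} (<-trans 0<-AB₂ -AB₂<B-A₂)
        B≢0 : B ≢ 0ℤ
        B≢0 = ≢-sym (<⇒≢ 0<B)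
    ... | inj₁ 0≤B | tri< 0<A _ _ | _ = inj₂ (inj₁ (0<A , 0≤B))
    ... | inj₁ 0≤B | tri≈ _ 0≡A _ | cross = inj₁ (≤-reflexive 0≡A , 0<B)
      where
        B = B₁ + B₂
        0<BA₁ : 0ℤ < B * A₁
        0<BA₁ = subst (0ℤ <_) (trans (cross-identity₃ A₁ B₁ A₂ B₂) (trans (cong (λ a → B * A₁ - a * B₁) (sym 0≡A)) (+-identityʳ (B * A₁))))
                  (i<j⇒0<j-i cross)
        0<B : 0ℤ < B
        0<B = *-cancelʳ-<-nonNeg A₁ {{nonNegative (<⇒≤ 0<A₁)}} 0<BA₁

    private
      commute : ∀ {x y} → RealPos D (y ⊕ x) → RealPos D (x ⊕ y)
      commute {x} {y} = subst (RealPos D) (⊕-comm y x)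

    RealPos-⊕ : ∀ {x y} → RealPos D x → RealPos D y → RealPos D (x ⊕ y)
    RealPos-⊕ {A₁ , B₁} {A₂ , B₂} p q with view p | view q
    ... | nonneg a b s | nonneg c d t =
      nonneg⇒RealPos (+-mono-≤ a c) (+-mono-≤ b d) (subst (0ℤ <_) (interchange A₁ B₁ A₂ B₂) (+-mono-< s t))
    ... | nonneg a b _      | rational-dom c d r = nonneg+rational-dom a b c d r
    ... | nonneg a b _      | surd-dom c d r     = nonneg+surd-dom a b c d r
    ... | rational-dom a b r | nonneg c d _      = commute {A₁ , B₁} {A₂ , B₂} (nonneg+rational-dom c d a b r)
    ... | rational-dom a b r | rational-dom c d s = rational-dom+rational-dom a b r c d s
    ... | rational-dom a b r | surd-dom c d s     = rational-dom+surd-dom a b r c d s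
    ... | surd-dom a b r     | nonneg c d _       = commute {A₁ , B₁} {A₂ , B₂} (nonneg+surd-dom c d a b r)
    ... | surd-dom a b r     | rational-dom c d s = commute {A₁ , B₁} {A₂ , B₂} (rational-dom+surd-dom c d s a b r)
    ... | surd-dom a b r     | surd-dom c d s     = surd-dom+surd-dom a b r c d s

    ¬RealPos-0 : ¬ RealPos D 0K
    ¬RealPos-0 (inj₁ (_ , 0<0))               = <-irrefl refl 0<0
    ¬RealPos-0 (inj₂ (inj₁ (0<0 , _)))        = <-irrefl refl 0<0
    ¬RealPos-0 (inj₂ (inj₂ (inj₁ (0<0 , _)))) = <-irrefl refl 0<0
    ¬RealPos-0 (inj₂ (inj₂ (inj₂ (0<0 , _)))) = <-irrefl refl 0<0

    RealPos-asym : ∀ {x} → RealPos D x → ¬ RealPos D (negK x)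
    RealPos-asym {A , B} p q = ¬RealPos-0 (subst (RealPos D) (cong₂ _,_ (+-inverseʳ A) (+-inverseʳ B)) (RealPos-⊕ p q))

    RealPos-total : Squarefree D → 2 ℕ.≤ D → ∀ {x} → x ≢ 0K → RealPos D x ⊎ RealPos D (negK x)
    RealPos-total sf 2≤D {A , B} x≢0 with <-cmp 0ℤ A | <-cmp 0ℤ B
    ... | tri< 0<A _ _ | tri< 0<B _ _   = inj₁ (inj₂ (inj₁ (0<A , <⇒≤ 0<B)))
    ... | tri< 0<A _ _ | tri≈ _ refl _  = inj₁ (inj₂ (inj₁ (0<A , ≤-refl)))
    ... | tri< 0<A _ _ | tri> _ _ B<0 with <-cmp (B * B * + D) (A * A)
    ...   | tri< q _ _ = inj₁ (inj₂ (inj₂ (inj₁ (0<A , B<0 , q))))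
    ...   | tri≈ _ q _ = ⊥-elim (squarefree⇒i²≢j²D sf 2≤D A B (<⇒≢ B<0) (sym q))
    ...   | tri> _ _ q = inj₂ (inj₂ (inj₂ (inj₂ (neg-mono-< 0<A , neg-mono-< B<0 ,
                           subst₂ (λ a b → a < b * + D) (sym (neg*neg A A)) (sym (neg*neg B B)) q))))
    RealPos-total sf 2≤D x≢0 | tri≈ _ refl _ | tri< 0<B _ _  = inj₁ (inj₁ (≤-refl , 0<B))
    RealPos-total sf 2≤D x≢0 | tri≈ _ refl _ | tri≈ _ refl _ = ⊥-elim (x≢0 refl)
    RealPos-total sf 2≤D x≢0 | tri≈ _ refl _ | tri> _ _ B<0  = inj₂ (inj₁ (≤-refl , neg-mono-< B<0))
    RealPos-total sf 2≤D {A , B} x≢0 | tri> _ _ A<0 | tri< 0<B _ _ with <-cmp (A * A) (B * B * + D)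
    ...   | tri< q _ _ = inj₁ (inj₂ (inj₂ (inj₂ (A<0 , 0<B , q))))
    ...   | tri≈ _ q _ = ⊥-elim (squarefree⇒i²≢j²D sf 2≤D A B (≢-sym (<⇒≢ 0<B)) q)
    ...   | tri> _ _ q = inj₂ (inj₂ (inj₂ (inj₁ (neg-mono-< A<0 , neg-mono-< 0<B ,
                           subst₂ (λ b a → b * + D < a) (sym (neg*neg B B)) (sym (neg*neg A A)) q))))
    RealPos-total sf 2≤D x≢0 | tri> _ _ A<0 | tri≈ _ refl _ = inj₂ (inj₂ (inj₁ (neg-mono-< A<0 , ≤-refl)))
    RealPos-total sf 2≤D x≢0 | tri> _ _ A<0 | tri> _ _ B<0  = inj₂ (inj₂ (inj₁ (neg-mono-< A<0 , <⇒≤ (neg-mono-< B<0))))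

  realPos-isPositiveCone : ∀ {D} → Squarefree D → 2 ℕ.≤ D → IsPositiveCone (RealPos D)
  realPos-isPositiveCone sf 2≤D = record
    { ⊕-closed = RealPos-⊕
    ; total    = RealPos-total sf 2≤D
    ; asym     = RealPos-asym
    }

  conj : ℤ × ℤ → ℤ × ℤ
  conj (A , B) = A , - B

  -- Positivity of x under the two real embeddings of K, √D ↦ √D and √D ↦ -√D.
  Pos : ℕ → OK → Set
  Pos D x = RealPos D (dbl D x)

  Pos′ : ℕ → OK → Set
  Pos′ D x = RealPos D (conj (dbl D x))

  isLinearInjection-resp : ∀ {f g} → (∀ x → f x ≡ g x) → IsLinearInjection g → IsLinearInjection f
  isLinearInjection-resp {f} {g} f≗g G = record
    { ⊕-hom     = λ x y → trans (f≗g (x ⊕ y)) (trans (G.⊕-hom x y) (sym (cong₂ _⊕_ (f≗g x) (f≗g y))))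
    ; neg-hom   = λ x → trans (f≗g (negK x)) (trans (G.neg-hom x) (sym (cong negK (f≗g x))))
    ; injective = λ {x} fx≡0 → G.injective (trans (sym (f≗g x)) fx≡0)
    }
    where module G = IsLinearInjection G

  private
    2*-injective : ∀ {x} → + 2 * x ≡ 0ℤ → x ≡ 0ℤ
    2*-injective {x} e = *-cancelˡ-≡ (+ 2) x 0ℤ (trans e (sym (*-zeroʳ (+ 2))))

    dbl₁ dbl₂ : OK → ℤ × ℤ
    dbl₁ (x , y) = + 2 * x + y , y
    dbl₂ (x , y) = + 2 * x , + 2 * y

    dbl₁-isLinearInjection : IsLinearInjection dbl₁
    dbl₁-isLinearInjection = record
      { ⊕-hom     = λ (x , y) (x′ , y′) → cong₂ _,_ (⊕-identity x y x′ y′) refl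
      ; neg-hom   = λ (x , y) → cong₂ _,_ (neg-identity x y) refl
      ; injective = λ { {x , y} e → cong₂ _,_ (2*-injective (begin
          + 2 * x       ≡⟨ +-identityʳ (+ 2 * x) ⟨
          + 2 * x + 0ℤ  ≡⟨ cong (λ z → + 2 * x + z) (cong proj₂ e) ⟨
          + 2 * x + y   ≡⟨ cong proj₁ e ⟩
          0ℤ            ∎)) (cong proj₂ e) }
      }
      where
        open ≡-Reasoning
        ⊕-identity : ∀ x y x′ y′ → + 2 * (x + x′) + (y + y′) ≡ (+ 2 * x + y) + (+ 2 * x′ + y′)
        ⊕-identity = solve-∀
        neg-identity : ∀ x y → + 2 * - x + - y ≡ - (+ 2 * x + y)
        neg-identity = solve-∀

    dbl₂-isLinearInjection : IsLinearInjection dbl₂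
    dbl₂-isLinearInjection = record
      { ⊕-hom     = λ (x , y) (x′ , y′) → cong₂ _,_ (*-distribˡ-+ (+ 2) x x′) (*-distribˡ-+ (+ 2) y y′)
      ; neg-hom   = λ (x , y) → cong₂ _,_ (sym (neg-distribʳ-* (+ 2) x)) (sym (neg-distribʳ-* (+ 2) y))
      ; injective = λ e → cong₂ _,_ (2*-injective (cong proj₁ e)) (2*-injective (cong proj₂ e))
      }

    dbl-cases : ∀ D → (∀ x y → dbl D (x , y) ≡ dbl₁ (x , y)) ⊎ (∀ x y → dbl D (x , y) ≡ dbl₂ (x , y))
    dbl-cases D with D ℕ.% 4
    ... | 0           = inj₂ λ _ _ → refl
    ... | 1           = inj₁ λ _ _ → refl
    ... | suc (suc _) = inj₂ λ _ _ → refl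

  dbl-isLinearInjection : ∀ D → IsLinearInjection (dbl D)
  dbl-isLinearInjection D with dbl-cases D
  ... | inj₁ dbl≗dbl₁ = isLinearInjection-resp (λ _ → dbl≗dbl₁ _ _) dbl₁-isLinearInjection
  ... | inj₂ dbl≗dbl₂ = isLinearInjection-resp (λ _ → dbl≗dbl₂ _ _) dbl₂-isLinearInjection

  conj-isLinearInjection : IsLinearInjection conj
  conj-isLinearInjection = record
    { ⊕-hom     = λ (a , b) (c , d) → cong (a + c ,_) (neg-distrib-+ b d)
    ; neg-hom   = λ _ → refl
    ; injective = λ { {a , b} e → cong₂ _,_ (cong proj₁ e) (trans (sym (neg-involutive b)) (cong -_ (cong proj₂ e))) }
    }

  pos-isPositiveCone : ∀ {D} → Squarefree D → 2 ℕ.≤ D → IsPositiveCone (Pos D)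
  pos-isPositiveCone {D} sf 2≤D = isPositiveCone-pullback (dbl-isLinearInjection D) (realPos-isPositiveCone sf 2≤D)

  pos′-isPositiveCone : ∀ {D} → Squarefree D → 2 ℕ.≤ D → IsPositiveCone (Pos′ D)
  pos′-isPositiveCone {D} sf 2≤D =
    isPositiveCone-pullback (∘-isLinearInjection (dbl-isLinearInjection D) conj-isLinearInjection) (realPos-isPositiveCone sf 2≤D)

  module _ {D : ℕ} where

    private
      RealPos-B<0 : ∀ {A B} → RealPos D (A , B) → B < 0ℤ → 0ℤ < A × B * B * + D < A * A
      RealPos-B<0 {A} {B} p B<0 with view {D} {A} {B} p
      ... | nonneg _ 0≤B _         = ⊥-elim (<-irrefl refl (<-≤-trans B<0 0≤B))
      ... | rational-dom 0<A _ q   = 0<A , q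
      ... | surd-dom _ 0<B _       = ⊥-elim (<-asym B<0 0<B)

      RealPos-B≡0 : ∀ {A} → RealPos D (A , 0ℤ) → 0ℤ < A
      RealPos-B≡0 {A} p with view {D} {A} {0ℤ} p
      ... | nonneg _ _ 0<A+0     = subst (0ℤ <_) (+-identityʳ A) 0<A+0
      ... | rational-dom 0<A _ _ = 0<A
      ... | surd-dom _ 0<0 _     = ⊥-elim (<-irrefl refl 0<0)

      split : ∀ {A B} → 0ℤ < A → B * B * + D < A * A → RealPos D (A , B) × RealPos D (A , - B)
      split {A} {B} 0<A q with <-cmp B 0ℤ
      ... | tri< B<0 _ _  = inj₂ (inj₂ (inj₁ (0<A , B<0 , q))) , inj₂ (inj₁ (0<A , <⇒≤ (neg-mono-< B<0)))
      ... | tri≈ _ refl _ = inj₂ (inj₁ (0<A , ≤-refl)) , inj₂ (inj₁ (0<A , ≤-refl))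
      ... | tri> _ _ 0<B  = inj₂ (inj₁ (0<A , <⇒≤ 0<B)) ,
                            inj₂ (inj₂ (inj₁ (0<A , neg-mono-< 0<B , subst (λ b → b * + D < A * A) (sym (neg*neg B B)) q)))

      merge : ∀ {A B} → RealPos D (A , B) → RealPos D (A , - B) → 0ℤ < A × B * B * + D < A * A
      merge {A} {B} p p′ with <-cmp B 0ℤ
      ... | tri< B<0 _ _  = RealPos-B<0 p B<0
      ... | tri≈ _ refl _ = RealPos-B≡0 p , square-pos (≢-sym (<⇒≢ (RealPos-B≡0 p)))
      ... | tri> _ _ 0<B  with RealPos-B<0 p′ (neg-mono-< 0<B)
      ...   | 0<A , q = 0<A , subst (λ b → b * + D < A * A) (neg*neg B B) q

    TotPos⇒Pos×Pos′ : ∀ {x} → TotPos D x → Pos D x × Pos′ D x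
    TotPos⇒Pos×Pos′ (0<A , q) = split 0<A q

    Pos×Pos′⇒TotPos : ∀ {x} → Pos D x → Pos′ D x → TotPos D x
    Pos×Pos′⇒TotPos = merge

  totPos-isCone : ∀ {D} → Squarefree D → 2 ℕ.≤ D → IsCone (TotPos D)
  totPos-isCone {D} sf 2≤D = isCone-resp (λ {x} (p , p′) → Pos×Pos′⇒TotPos {D} {x} p p′) (λ {x} → TotPos⇒Pos×Pos′ {D} {x})
    (∩-isCone (IsPositiveCone.isCone (pos-isPositiveCone sf 2≤D)) (IsPositiveCone.isCone (pos′-isPositiveCone sf 2≤D)))

  -- Consecutive indecomposables form a basis

  *-pres-∣ : ∀ {i j k l} → i ∣ j → k ∣ l → i * k ∣ j * l
  *-pres-∣ {i} {j} {k} {l} i∣j k∣l = ∣-trans (*-monoˡ-∣ k i∣j) (*-monoʳ-∣ j k∣l)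

  square∣det : ∀ {d} x y → d ∣ proj₁ x → d ∣ - proj₂ x → d ∣ - proj₁ y → d ∣ proj₂ y → d * d ∣ det x y
  square∣det {d} (a , b) (c , e) d∣a d∣-b d∣-c d∣e =
    subst (d * d ∣_) (neg-square-cancel a b c e) (∣m∣n⇒∣m-n (*-pres-∣ d∣a d∣e) (*-pres-∣ d∣-b d∣-c))
    where neg-square-cancel : ∀ a b c e → a * e - - b * - c ≡ a * e - b * c
          neg-square-cancel = solve-∀

  private
    far-corner-⋆ : ∀ N r s x y γ → N ⋆ γ ≡ r ⋆ x ⊕ s ⋆ y → N ⋆ (y ⊖ γ) ≡ r ⋆ (y ⊖ x) ⊕ (N - r - s) ⋆ y
    far-corner-⋆ N r s (a , b) (c , e) (g , h) eq =
      cong₂ _,_ (componentwise a c g (cong proj₁ eq)) (componentwise b e h (cong proj₂ eq))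
      where
        componentwise : ∀ a c g → N * g ≡ r * a + s * c → N * (c - g) ≡ r * (c - a) + (N - r - s) * c
        componentwise a c g h = by-hypothesis h (solve (N ∷ r ∷ s ∷ a ∷ c ∷ g ∷ []))

    reflection-⋆ : ∀ N r s x y γ → N ⋆ γ ≡ r ⋆ x ⊕ s ⋆ y → N ⋆ ((x ⊕ y) ⊖ γ) ≡ (N - r) ⋆ x ⊕ (N - s) ⋆ y
    reflection-⋆ N r s (a , b) (c , e) (g , h) eq =
      cong₂ _,_ (componentwise a c g (cong proj₁ eq)) (componentwise b e h (cong proj₂ eq))
      where
        componentwise : ∀ a c g → N * g ≡ r * a + s * c → N * ((a + c) - g) ≡ (N - r) * a + (N - s) * c
        componentwise a c g h = by-hypothesis h (solve (N ∷ r ∷ s ∷ a ∷ c ∷ g ∷ []))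

    dependence-⋆₁ : ∀ x y b₀ b₁ → x ⋆ b₀ ⊕ y ⋆ b₁ ≡ 0K → x ⋆ (b₁ ⊖ b₀) ≡ (x + y) ⋆ b₁
    dependence-⋆₁ x y (a , b) (c , e) eq =
      cong₂ _,_ (componentwise a c (cong proj₁ eq)) (componentwise b e (cong proj₂ eq))
      where
        componentwise : ∀ a c → x * a + y * c ≡ 0ℤ → x * (c - a) ≡ (x + y) * c
        componentwise a c h = by-hypothesis h (solve (x ∷ y ∷ a ∷ c ∷ []))

    dependence-⋆₂ : ∀ x y b₀ b₁ → x ⋆ b₀ ⊕ y ⋆ b₁ ≡ 0K → x ⋆ (b₀ ⊖ b₁) ≡ (- (x + y)) ⋆ b₁
    dependence-⋆₂ x y (a , b) (c , e) eq =
      cong₂ _,_ (componentwise a c (cong proj₁ eq)) (componentwise b e (cong proj₂ eq))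
      where
        componentwise : ∀ a c → x * a + y * c ≡ 0ℤ → x * (a - c) ≡ - (x + y) * c
        componentwise a c h = by-hypothesis (sym h) (solve (x ∷ y ∷ a ∷ c ∷ []))

    remainder-⋆ : ∀ N r s q₁ q₂ b₀ b₁ u → (r + q₁ * N) ⋆ b₀ ⊕ (s + q₂ * N) ⋆ b₁ ≡ N ⋆ u →
                  N ⋆ (u ⊖ (q₁ ⋆ b₀ ⊕ q₂ ⋆ b₁)) ≡ r ⋆ b₀ ⊕ s ⋆ b₁
    remainder-⋆ N r s q₁ q₂ (a , b) (c , e) (u , v) eq =
      cong₂ _,_ (componentwise a c u (cong proj₁ eq)) (componentwise b e v (cong proj₂ eq))
      where
        componentwise : ∀ a c u → (r + q₁ * N) * a + (s + q₂ * N) * c ≡ N * u → N * (u - (q₁ * a + q₂ * c)) ≡ r * a + s * c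
        componentwise a c u h = by-hypothesis h (solve (N ∷ u ∷ r ∷ s ∷ q₁ ∷ q₂ ∷ a ∷ c ∷ []))

    adjugate₁ : ∀ x y → proj₂ y ⋆ x ⊕ (- proj₂ x) ⋆ y ≡ det x y ⋆ (1ℤ , 0ℤ)
    adjugate₁ (a , b) (c , e) = cong₂ _,_ (first a b c e) (second a b c e)
      where
        first : ∀ a b c e → e * a + - b * c ≡ (a * e - b * c) * 1ℤ
        first = solve-∀
        second : ∀ a b c e → e * b + - b * e ≡ (a * e - b * c) * 0ℤ
        second = solve-∀

    adjugate₂ : ∀ x y → (- proj₁ y) ⋆ x ⊕ proj₁ x ⋆ y ≡ det x y ⋆ (0ℤ , 1ℤ)
    adjugate₂ (a , b) (c , e) = cong₂ _,_ (first a b c e) (second a b c e)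
      where
        first : ∀ a b c e → - c * a + a * c ≡ (a * e - b * c) * 0ℤ
        first = solve-∀
        second : ∀ a b c e → - c * b + a * e ≡ (a * e - b * c) * 1ℤ
        second = solve-∀

  below-vertex : ∀ {Q} → IsCone Q → ∀ N r s x y γ → 0ℤ ≤ r → 0ℤ ≤ s → s < N → r + s ≤ N →
                     Q (y ⊖ x) → Q y → N ⋆ γ ≡ r ⋆ x ⊕ s ⋆ y → Q (y ⊖ γ)
  below-vertex {Q} cone N r s x y γ 0≤r 0≤s s<N r+s≤N Qy-x Qy Nγ≡ =
    ⋆-cancel {N} (≤-<-trans 0≤s s<N) (subst Q (sym (far-corner-⋆ N r s x y γ Nγ≡))
      (⋆⊕⋆-closed {r} {N - r - s} 0≤r 0≤N-r-s (subst (0ℤ <_) (sym (r+[N-r-s]≡N-s N r s)) (i<j⇒0<j-i s<N)) Qy-x Qy))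
    where
      open IsCone cone
      r+[N-r-s]≡N-s : ∀ N r s → r + (N - r - s) ≡ N - s
      r+[N-r-s]≡N-s = solve-∀
      0≤N-r-s : 0ℤ ≤ N - r - s
      0≤N-r-s = subst (0ℤ ≤_) (N-[r+s]≡N-r-s N r s) (i≤j⇒0≤j-i r+s≤N)
        where N-[r+s]≡N-r-s : ∀ N r s → N - (r + s) ≡ N - r - s
              N-[r+s]≡N-r-s = solve-∀

  -- P and P′ stand for positivity under the two real embeddings; height only has to be positive
  -- on P ∩ P′, to support the induction in indecomposable-below.
  module ConsecutiveBasis
    {P P′ : OK → Set} (pos : IsPositiveCone P) (pos′ : IsPositiveCone P′)
    (height : OK → ℤ) (height-⊕ : ∀ x y → height (x ⊕ y) ≡ height x + height y)
    (height-pos : ∀ {x} → (P ∩ P′) x → 0ℤ < height x)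
    {b₀ b₁ : OK} (b₀-indec : IndecomposableIn (P ∩ P′) b₀) (b₁-indec : IndecomposableIn (P ∩ P′) b₁)
    (b₀<b₁ : P (b₁ ⊖ b₀))
    (nothing-between : ∀ δ → IndecomposableIn (P ∩ P′) δ → ¬ (P (δ ⊖ b₀) × P (b₁ ⊖ δ)))
    where

    private
      C = P ∩ P′
      module P = IsPositiveCone pos
      module P′ = IsPositiveCone pos′
      module C = IsCone (∩-isCone P.isCone P′.isCone)

    -- Doubly negated, as decomposability is not decidable.
    indecomposable-below : ∀ {γ} → C γ → ¬ (∀ δ → IndecomposableIn C δ → ¬ OrZero C (γ ⊖ δ))
    indecomposable-below Cγ = go _ Cγ ℕ.≤-refl
      where
        go : ∀ n {γ} → C γ → ∣ height γ ∣ ℕ.< n → ¬ (∀ δ → IndecomposableIn C δ → ¬ OrZero C (γ ⊖ δ))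
        go (suc n) {γ} Cγ ∣hγ∣<1+n none = none γ (Cγ , indecomposable) (inj₁ (⊖-self γ))
          where
            indecomposable : ¬ (Σ OK λ β → Σ OK λ γ′ → C β × C γ′ × γ ≡ β ⊕ γ′)
            indecomposable (β , γ′ , Cβ , Cγ′ , refl) = go n Cβ ∣hβ∣<n λ δ δ-indec C₀β-δ →
              none δ δ-indec (inj₂ (subst C (sym (⊕-⊖-comm β γ′ δ)) (C.₀⊕-closed C₀β-δ Cγ′)))
              where
                hβ<hγ : height β < height (β ⊕ γ′)
                hβ<hγ = subst (height β <_) (sym (height-⊕ β γ′))
                          (subst (_< height β + height γ′) (+-identityʳ (height β)) (+-monoʳ-< (height β) (height-pos Cγ′)))
                ∣hβ∣<n : ∣ height β ∣ ℕ.< n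
                ∣hβ∣<n = ℕ.<-≤-trans (nonneg-abs-< (<⇒≤ (height-pos Cβ)) hβ<hγ) (ℕ.≤-pred ∣hγ∣<1+n)
                  where nonneg-abs-< : ∀ {i j} → 0ℤ ≤ i → i < j → ∣ i ∣ ℕ.< ∣ j ∣
                        nonneg-abs-< {+ _} {+ _} _ (+<+ m<n) = m<n

    b₁′<b₀′ : P′ (b₀ ⊖ b₁)
    b₁′<b₀′ = indecomposable-order-flip pos′ pos
      (indecomposableIn-resp swap swap b₁-indec) (swap (proj₁ b₀-indec)) b₀<b₁

    no-element-below-b₁-and-b₀′ : ∀ {γ} → C γ → P (b₁ ⊖ γ) → P′ (b₀ ⊖ γ) → ⊥
    no-element-below-b₁-and-b₀′ {γ} Cγ Pb₁-γ P′b₀-γ = indecomposable-below Cγ λ δ δ-indec C₀γ-δ →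
      nothing-between δ δ-indec
        ( indecomposable-order-flip pos pos′ b₀-indec (proj₁ δ-indec)
            (subst P′ (⊖-telescope b₀ γ δ) (P′.⊕-closed₀ P′b₀-γ (map₂ proj₂ C₀γ-δ)))
        , subst P (⊖-telescope b₁ γ δ) (P.⊕-closed₀ Pb₁-γ (map₂ proj₁ C₀γ-δ)))

    no-lattice-point-in-triangle : ∀ N r s γ → 0ℤ ≤ r → 0ℤ ≤ s → 0ℤ < r + s → r < N → s < N → r + s ≤ N →
                                   N ⋆ γ ≡ r ⋆ b₀ ⊕ s ⋆ b₁ → ⊥
    no-lattice-point-in-triangle N r s γ 0≤r 0≤s 0<r+s r<N s<N r+s≤N Nγ≡ =
      no-element-below-b₁-and-b₀′
        (C.⋆-cancel (<-≤-trans 0<r+s r+s≤N) (subst C (sym Nγ≡) (C.⋆⊕⋆-closed 0≤r 0≤s 0<r+s (proj₁ b₀-indec) (proj₁ b₁-indec))))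
        (below-vertex P.isCone N r s b₀ b₁ γ 0≤r 0≤s s<N r+s≤N b₀<b₁ (proj₁ (proj₁ b₁-indec)) Nγ≡)
        (below-vertex P′.isCone N s r b₁ b₀ γ 0≤s 0≤r r<N (subst (_≤ N) (+-comm r s) r+s≤N) b₁′<b₀′ (proj₂ (proj₁ b₀-indec))
          (trans Nγ≡ (⊕-comm (r ⋆ b₀) (s ⋆ b₁))))

    no-lattice-point-in-parallelogram : ∀ N r s γ → 0ℤ ≤ r → 0ℤ ≤ s → 0ℤ < r + s → r < N → s < N →
                                        N ⋆ γ ≡ r ⋆ b₀ ⊕ s ⋆ b₁ → ⊥
    no-lattice-point-in-parallelogram N r s γ 0≤r 0≤s 0<r+s r<N s<N Nγ≡ with r + s ≤? N
    ... | yes r+s≤N = no-lattice-point-in-triangle N r s γ 0≤r 0≤s 0<r+s r<N s<N r+s≤N Nγ≡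
    ... | no  r+s≰N = no-lattice-point-in-triangle N (N - r) (N - s) ((b₀ ⊕ b₁) ⊖ γ) (<⇒≤ 0<N-r) (<⇒≤ 0<N-s) (+-mono-< 0<N-r 0<N-s)
                        (<-by-difference r (N-[N-r]≡r N r) 0<r) (<-by-difference s (N-[N-r]≡r N s) 0<s)
                        (≤-by-difference (r + s - N) (N-[[N-r]+[N-s]]≡r+s-N N r s) (<⇒≤ (i<j⇒0<j-i N<r+s)))
                        (reflection-⋆ N r s b₀ b₁ γ Nγ≡)
      where
        N<r+s = ≰⇒> r+s≰N
        0<N-r = i<j⇒0<j-i r<N
        0<N-s = i<j⇒0<j-i s<N
        0<r : 0ℤ < r
        0<r = subst (0ℤ <_) (r+s-N+[N-s]≡r N r s) (+-mono-< (i<j⇒0<j-i N<r+s) 0<N-s)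
          where r+s-N+[N-s]≡r : ∀ N r s → (r + s - N) + (N - s) ≡ r
                r+s-N+[N-s]≡r = solve-∀
        0<s : 0ℤ < s
        0<s = subst (0ℤ <_) (r+s-N+[N-r]≡s N r s) (+-mono-< (i<j⇒0<j-i N<r+s) 0<N-r)
          where r+s-N+[N-r]≡s : ∀ N r s → (r + s - N) + (N - r) ≡ s
                r+s-N+[N-r]≡s = solve-∀
        N-[N-r]≡r : ∀ N r → N - (N - r) ≡ r
        N-[N-r]≡r = solve-∀
        N-[[N-r]+[N-s]]≡r+s-N : ∀ N r s → N - ((N - r) + (N - s)) ≡ r + s - N
        N-[[N-r]+[N-s]]≡r+s-N = solve-∀

    private
      positive-coefficient-impossible : ∀ x y → 0ℤ < x → x ⋆ b₀ ⊕ y ⋆ b₁ ≡ 0K → ⊥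
      positive-coefficient-impossible x y 0<x eq = <-asym 0<x+y (neg-cancel-< {0ℤ} {x + y} 0<-[x+y])
        where
          0<x+y : 0ℤ < x + y
          0<x+y = P.⋆-sign (proj₁ (proj₁ b₁-indec)) (subst P (dependence-⋆₁ x y b₀ b₁ eq) (P.⋆-closed 0<x b₀<b₁))
          0<-[x+y] : 0ℤ < - (x + y)
          0<-[x+y] = P′.⋆-sign (proj₂ (proj₁ b₁-indec)) (subst P′ (dependence-⋆₂ x y b₀ b₁ eq) (P′.⋆-closed 0<x b₁′<b₀′))

    independent : ∀ x y → x ⋆ b₀ ⊕ y ⋆ b₁ ≡ 0K → x ≡ 0ℤ
    independent x y eq with <-cmp 0ℤ x
    ... | tri≈ _ 0≡x _ = sym 0≡x
    ... | tri< 0<x _ _ = ⊥-elim (positive-coefficient-impossible x y 0<x eq)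
    ... | tri> _ _ x<0 = ⊥-elim (positive-coefficient-impossible (- x) (- y) (neg-mono-< x<0)
                            (trans (cong₂ _⊕_ (sym (neg-⋆ x b₀)) (sym (neg-⋆ y b₁))) (trans (sym (neg-⊕ (x ⋆ b₀) (y ⋆ b₁))) (cong negK eq))))

    private
      zero-remainders : ∀ N γ m n → m ℕ.< ∣ N ∣ → n ℕ.< ∣ N ∣ → N ⋆ γ ≡ (+ m) ⋆ b₀ ⊕ (+ n) ⋆ b₁ → m ≡ 0 × n ≡ 0
      zero-remainders N γ zero    zero    _   _   _  = refl , refl
      zero-remainders N γ (suc m) n       m<N n<N eq = ⊥-elim (no-lattice-point-in-parallelogram
        (+ ∣ N ∣) (+ suc m) (+ n) _ (+≤+ z≤n) (+≤+ z≤n) (+<+ (s≤s z≤n)) (+<+ m<N) (+<+ n<N) (trans (proj₂ (abs-⋆ N γ)) eq))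
      zero-remainders N γ zero    (suc n) m<N n<N eq = ⊥-elim (no-lattice-point-in-parallelogram
        (+ ∣ N ∣) (+ 0) (+ suc n) _ (+≤+ z≤n) (+≤+ z≤n) (+<+ (s≤s z≤n)) (+<+ m<N) (+<+ n<N) (trans (proj₂ (abs-⋆ N γ)) eq))

    saturated : ∀ N x y u → N ≢ 0ℤ → x ⋆ b₀ ⊕ y ⋆ b₁ ≡ N ⋆ u → (N ∣ x) × (N ∣ y)
    saturated N x y u N≢0 eq = divides (x / N) (multiple x (proj₁ remainders-zero)) , divides (y / N) (multiple y (proj₂ remainders-zero))
      where
        instance
          _ = ≢-nonZero N≢0
        remainders-zero : x % N ≡ 0 × y % N ≡ 0
        remainders-zero = zero-remainders N (u ⊖ ((x / N) ⋆ b₀ ⊕ (y / N) ⋆ b₁)) (x % N) (y % N) (n%d<d x N) (n%d<d y N)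
          (remainder-⋆ N (+ (x % N)) (+ (y % N)) (x / N) (y / N) b₀ b₁ u
            (subst₂ (λ x y → x ⋆ b₀ ⊕ y ⋆ b₁ ≡ N ⋆ u) (a≡a%n+[a/n]*n x N) (a≡a%n+[a/n]*n y N) eq))
        multiple : ∀ z → z % N ≡ 0 → z ≡ (z / N) * N
        multiple z z%N≡0 = trans (a≡a%n+[a/n]*n z N) (trans (cong (λ m → + m + (z / N) * N) z%N≡0) (+-identityˡ _))

    ∣det∣≡1 : ∣ det b₀ b₁ ∣ ≡ 1
    ∣det∣≡1 = ℕ.∣1⇒≡1 (∣⇒∣ᵤ (*-cancelˡ-∣ d {{≢-nonZero d≢0}} (subst (d * d ∣_) (sym (*-identityʳ d))
                (square∣det b₀ b₁ d∣a d∣-b d∣-c d∣e))))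
      where
        d = det b₀ b₁
        d≢0 : d ≢ 0ℤ
        d≢0 d≡0 = C.0∉ (subst C (cong₂ _,_ c≡0 e≡0) (proj₁ b₁-indec))
          where
            e≡0 = independent (proj₂ b₁) (- proj₂ b₀) (trans (adjugate₁ b₀ b₁) (cong (_⋆ (1ℤ , 0ℤ)) d≡0))
            c≡0 = neg-injective (independent (- proj₁ b₁) (proj₁ b₀) (trans (adjugate₂ b₀ b₁) (cong (_⋆ (0ℤ , 1ℤ)) d≡0)))
        d∣e×d∣-b = saturated d (proj₂ b₁) (- proj₂ b₀) (1ℤ , 0ℤ) d≢0 (adjugate₁ b₀ b₁)
        d∣-c×d∣a = saturated d (- proj₁ b₁) (proj₁ b₀) (0ℤ , 1ℤ) d≢0 (adjugate₂ b₀ b₁)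
        d∣e = proj₁ d∣e×d∣-b
        d∣-b = proj₂ d∣e×d∣-b
        d∣-c = proj₁ d∣-c×d∣a
        d∣a = proj₂ d∣-c×d∣a

  -- PartCount D and PartAtLeast D are PartCountOf (TotPos D) and PartAtLeastOf (TotPos D).
  IsRepOf : (OK → Set) → OK → List OK → Set
  IsRepOf C α L = L ≢ [] × All C L × sumK L ≡ α

  PartCountOf : (OK → Set) → OK → ℕ → Set
  PartCountOf C α n =
    Σ (List (List OK)) λ Ls →
      length Ls ≡ n × All (IsRepOf C α) Ls × AllPairs (λ L M → ¬ (L ↭ M)) Ls
      × (∀ L → IsRepOf C α L → Any (L ↭_) Ls)

  PartAtLeastOf : (OK → Set) → OK → ℕ → Set
  PartAtLeastOf C α n =
    Σ (List (List OK)) λ Ls →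
      n ℕ.≤ length Ls × All (IsRepOf C α) Ls × AllPairs (λ L M → ¬ (L ↭ M)) Ls

  module _ {f g : OK → OK} (f∘g : ∀ x → f (g x) ≡ x) (g∘f : ∀ x → g (f x) ≡ x)
           (f-⊕ : ∀ x y → f (x ⊕ y) ≡ f x ⊕ f y) (f-0 : f 0K ≡ 0K) {C : OK → Set} where

    private
      f-sum : ∀ L → sumK (map f L) ≡ f (sumK L)
      f-sum []      = sym f-0
      f-sum (x ∷ L) = trans (cong (f x ⊕_) (f-sum L)) (sym (f-⊕ x (sumK L)))

      map-f∘g : ∀ L → map f (map g L) ≡ L
      map-f∘g []      = refl
      map-f∘g (x ∷ L) = cong₂ _∷_ (f∘g x) (map-f∘g L)

      map-g∘f : ∀ L → map g (map f L) ≡ L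
      map-g∘f []      = refl
      map-g∘f (x ∷ L) = cong₂ _∷_ (g∘f x) (map-g∘f L)

      rep-forward : ∀ {α} L → IsRepOf (λ x → C (f x)) α L → IsRepOf C (f α) (map f L)
      rep-forward []      (L≢[] , _) = ⊥-elim (L≢[] refl)
      rep-forward (x ∷ L) (_ , Cs , ΣL≡α) = (λ ()) , All.map⁺ Cs , trans (f-sum (x ∷ L)) (cong f ΣL≡α)

      rep-backward : ∀ {α} L → IsRepOf C (f α) L → IsRepOf (λ x → C (f x)) α (map g L)
      rep-backward {α} L (L≢[] , Cs , ΣL≡fα) =
        (λ gL≡[] → L≢[] (trans (sym (map-f∘g L)) (cong (map f) gL≡[]))) ,
        All.map⁺ (All.map (λ {x} → subst C (sym (f∘g x))) Cs) ,
        (begin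
          sumK (map g L)             ≡⟨ g∘f _ ⟨
          g (f (sumK (map g L)))     ≡⟨ cong g (f-sum (map g L)) ⟨
          g (sumK (map f (map g L))) ≡⟨ cong (g ∘ sumK) (map-f∘g L) ⟩
          g (sumK L)                 ≡⟨ cong g ΣL≡fα ⟩
          g (f α)                    ≡⟨ g∘f α ⟩
          α                          ∎)
        where open ≡-Reasoning

      distinct-forward : ∀ {Ls} → AllPairs (λ L M → ¬ (L ↭ M)) Ls → AllPairs (λ L M → ¬ (L ↭ M)) (map (map f) Ls)
      distinct-forward = AllPairs.map⁺ ∘ AllPairs.map (λ {L} {M} L≁M fL↭fM →
        L≁M (subst₂ _↭_ (map-g∘f L) (map-g∘f M) (Perm.map⁺ g fL↭fM)))

    partCount-transport : ∀ {α n} → PartCountOf (λ x → C (f x)) α n → PartCountOf C (f α) n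
    partCount-transport {α} (Ls , len , reps , distinct , complete) =
      map (map f) Ls , trans (List.length-map (map f) Ls) len ,
      All.map⁺ (All.map (λ {L} → rep-forward L) reps) , distinct-forward distinct ,
      λ L L-rep → Any.map⁺ (Any.map (λ {M} gL↭M → subst (_↭ map f M) (map-f∘g L) (Perm.map⁺ f gL↭M))
                                     (complete (map g L) (rep-backward L L-rep)))

    partAtLeast-transport : ∀ {α n} → PartAtLeastOf (λ x → C (f x)) α n → PartAtLeastOf C (f α) n
    partAtLeast-transport {α} {n} (Ls , n≤len , reps , distinct) =
      map (map f) Ls , subst (n ℕ.≤_) (sym (List.length-map (map f) Ls)) n≤len ,
      All.map⁺ (All.map (λ {L} → rep-forward L) reps) , distinct-forward distinct

  module Coordinates {D : ℕ} (sf : Squarefree D) (2≤D : 2 ℕ.≤ D) {b₀ b₁ : OK} (b₀b₁ : Consecutive D b₀ b₁) where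

    combine : OK → OK
    combine (s , t) = s ⋆ b₀ ⊕ t ⋆ b₁

    combine-⊕ : ∀ x y → combine (x ⊕ y) ≡ combine x ⊕ combine y
    combine-⊕ (s , t) (s′ , t′) = cong₂ _,_ (distrib s s′ t t′ (proj₁ b₀) (proj₁ b₁)) (distrib s s′ t t′ (proj₂ b₀) (proj₂ b₁))
      where distrib : ∀ s s′ t t′ a c → (s + s′) * a + (t + t′) * c ≡ (s * a + t * c) + (s′ * a + t′ * c)
            distrib = solve-∀

    combine-⋆ : ∀ k x → combine (k ⋆ x) ≡ k ⋆ combine x
    combine-⋆ k (s , t) = cong₂ _,_ (assoc k s t (proj₁ b₀) (proj₁ b₁)) (assoc k s t (proj₂ b₀) (proj₂ b₁))
      where assoc : ∀ k s t a c → (k * s) * a + (k * t) * c ≡ k * (s * a + t * c)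
            assoc = solve-∀

    combine-⋆⊖ : ∀ k x y → combine (k ⋆ x ⊖ y) ≡ k ⋆ combine x ⊖ combine y
    combine-⋆⊖ k (s , t) (s′ , t′) =
      cong₂ _,_ (distrib k s t s′ t′ (proj₁ b₀) (proj₁ b₁)) (distrib k s t s′ t′ (proj₂ b₀) (proj₂ b₁))
      where distrib : ∀ k s t s′ t′ a c → (k * s - s′) * a + (k * t - t′) * c ≡ k * (s * a + t * c) - (s′ * a + t′ * c)
            distrib = solve-∀

    combine-e₀ : combine (1ℤ , 0ℤ) ≡ b₀
    combine-e₀ = cong₂ _,_ (trans (+-identityʳ _) (*-identityˡ _)) (trans (+-identityʳ _) (*-identityˡ _))

    combine-e₁ : combine (0ℤ , 1ℤ) ≡ b₁
    combine-e₁ = cong₂ _,_ (trans (+-identityˡ _) (*-identityˡ _)) (trans (+-identityˡ _) (*-identityˡ _))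

    private
      b₀-indec = proj₁ b₀b₁
      b₁-indec = proj₁ (proj₂ b₀b₁)
      b₀<b₁ = proj₁ (proj₂ (proj₂ b₀b₁))
      nothing-between = proj₂ (proj₂ (proj₂ b₀b₁))

      to-Pos∩Pos′ : ∀ {x} → Indecomposable D x → IndecomposableIn (Pos D ∩ Pos′ D) x
      to-Pos∩Pos′ {x} = indecomposableIn-resp (λ {y} → TotPos⇒Pos×Pos′ {D} {y}) (λ {y} (p , p′) → Pos×Pos′⇒TotPos {D} {y} p p′)

      from-Pos∩Pos′ : ∀ {x} → IndecomposableIn (Pos D ∩ Pos′ D) x → Indecomposable D x
      from-Pos∩Pos′ = indecomposableIn-resp (λ {y} (p , p′) → Pos×Pos′⇒TotPos {D} {y} p p′) (λ {y} → TotPos⇒Pos×Pos′ {D} {y})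

      open ConsecutiveBasis (pos-isPositiveCone sf 2≤D) (pos′-isPositiveCone sf 2≤D)
             (λ x → proj₁ (dbl D x)) (λ x y → cong proj₁ (IsLinearInjection.⊕-hom (dbl-isLinearInjection D) x y))
             (λ {x} (p , p′) → proj₁ (Pos×Pos′⇒TotPos {D} {x} p p′))
             (to-Pos∩Pos′ b₀-indec) (to-Pos∩Pos′ b₁-indec) b₀<b₁ (λ δ δ-indec → nothing-between δ (from-Pos∩Pos′ δ-indec))
        using (∣det∣≡1)

      d = det b₀ b₁

      d*d≡1 : d * d ≡ 1ℤ
      d*d≡1 = ∣i∣≡1⇒i*i≡1 d ∣det∣≡1

    coordinates : OK → OK
    coordinates (x , y) = d ⋆ (x * proj₂ b₁ - y * proj₁ b₁ , proj₁ b₀ * y - proj₂ b₀ * x)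

    combine∘coordinates : ∀ x → combine (coordinates x) ≡ x
    combine∘coordinates (x , y) = cong₂ _,_
      (trans (first (proj₁ b₀) (proj₂ b₀) (proj₁ b₁) (proj₂ b₁) x y) (trans (cong (_* x) d*d≡1) (*-identityˡ x)))
      (trans (second (proj₁ b₀) (proj₂ b₀) (proj₁ b₁) (proj₂ b₁) x y) (trans (cong (_* y) d*d≡1) (*-identityˡ y)))
      where
        first : ∀ a b c e x y → ((a * e - b * c) * (x * e - y * c)) * a + ((a * e - b * c) * (a * y - b * x)) * c
                                ≡ ((a * e - b * c) * (a * e - b * c)) * x
        first = solve-∀
        second : ∀ a b c e x y → ((a * e - b * c) * (x * e - y * c)) * b + ((a * e - b * c) * (a * y - b * x)) * e
                                 ≡ ((a * e - b * c) * (a * e - b * c)) * y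
        second = solve-∀

    coordinates∘combine : ∀ x → coordinates (combine x) ≡ x
    coordinates∘combine (s , t) = cong₂ _,_
      (trans (first (proj₁ b₀) (proj₂ b₀) (proj₁ b₁) (proj₂ b₁) s t) (trans (cong (_* s) d*d≡1) (*-identityˡ s)))
      (trans (second (proj₁ b₀) (proj₂ b₀) (proj₁ b₁) (proj₂ b₁) s t) (trans (cong (_* t) d*d≡1) (*-identityˡ t)))
      where
        first : ∀ a b c e s t → (a * e - b * c) * ((s * a + t * c) * e - (s * b + t * e) * c)
                                ≡ ((a * e - b * c) * (a * e - b * c)) * s
        first = solve-∀
        second : ∀ a b c e s t → (a * e - b * c) * (a * (s * b + t * e) - b * (s * a + t * c))
                                 ≡ ((a * e - b * c) * (a * e - b * c)) * t
        second = solve-∀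

    Cone : OK → Set
    Cone x = TotPos D (combine x)

    cone : IsCone Cone
    cone = isCone-pullback combine-⊕ combine-⋆ (totPos-isCone sf 2≤D)

    indecomposable-coordinates : ∀ {x y} → combine x ≡ y → Indecomposable D y → IndecomposableIn Cone x
    indecomposable-coordinates refl = indecomposable-pullback combine-⊕

    partCount-combine : ∀ {α n} → PartCountOf Cone α n → PartCount D (combine α) n
    partCount-combine = partCount-transport {combine} {coordinates} combine∘coordinates coordinates∘combine combine-⊕ refl {TotPos D}

    partAtLeast-combine : ∀ {α n} → PartAtLeastOf Cone α n → PartAtLeast D (combine α) n
    partAtLeast-combine = partAtLeast-transport {combine} {coordinates} combine∘coordinates coordinates∘combine combine-⊕ refl {TotPos D}

    combine-recurrence : ∀ v u w {x y z} → combine u ≡ y → combine w ≡ z → v · y ≡ x ⊕ z →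
                         combine ((+ v) ⋆ u ⊖ w) ≡ x
    combine-recurrence v u w refl refl y-relation =
      trans (combine-⋆⊖ (+ v) u w) (sym (recurrence-left v _ (combine u) (combine w) y-relation))

    combine-b₋₁ : ∀ {v b₋₁} → v · b₀ ≡ b₋₁ ⊕ b₁ → combine (+ v , -1ℤ) ≡ b₋₁
    combine-b₋₁ {v} b₀-relation =
      trans (cong combine (cong₂ _,_ (first (+ v)) (second (+ v)))) (combine-recurrence v (1ℤ , 0ℤ) (0ℤ , 1ℤ) combine-e₀ combine-e₁ b₀-relation)
      where
        first : ∀ v → v ≡ v * 1ℤ - 0ℤ
        first = solve-∀
        second : ∀ v → -1ℤ ≡ v * 0ℤ - 1ℤ
        second = solve-∀

    combine-b₂ : ∀ {v b₂} → v · b₁ ≡ b₀ ⊕ b₂ → combine (-1ℤ , + v) ≡ b₂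
    combine-b₂ {v} {b₂} b₁-relation =
      trans (cong combine (cong₂ _,_ (second (+ v)) (first (+ v))))
        (combine-recurrence v (0ℤ , 1ℤ) (1ℤ , 0ℤ) combine-e₁ combine-e₀ (trans b₁-relation (⊕-comm b₀ b₂)))
      where
        first : ∀ v → v ≡ v * 1ℤ - 0ℤ
        first = solve-∀
        second : ∀ v → -1ℤ ≡ v * 0ℤ - 1ℤ
        second = solve-∀

    combine-b₋₂ : ∀ {u v b₋₁ b₋₂} → u · b₋₁ ≡ b₋₂ ⊕ b₀ → combine (+ v , -1ℤ) ≡ b₋₁ →
                  combine (+ u * + v - 1ℤ , - + u) ≡ b₋₂
    combine-b₋₂ {u} {v} b₋₁-relation b₋₁-coordinates =
      trans (cong (λ t → combine (+ u * + v - 1ℤ , t)) (second (+ u)))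
        (combine-recurrence u (+ v , -1ℤ) (1ℤ , 0ℤ) b₋₁-coordinates combine-e₀ b₋₁-relation)
      where
        second : ∀ u → - u ≡ u * -1ℤ - 0ℤ
        second = solve-∀

    combine-α : combine (+ 2 , 1ℤ) ≡ (2 · b₀) ⊕ b₁
    combine-α = cong₂ _,_ (cong (λ z → + 2 * proj₁ b₀ + z) (*-identityˡ _)) (cong (λ z → + 2 * proj₂ b₀ + z) (*-identityˡ _))

  -- Counting partitions by enumeration

  _≟ᴷ_ : DecidableEquality OK
  _≟ᴷ_ = ≡-dec _≟_ _≟_

  private
    lexicographic : DecTotalOrder _ _ _
    lexicographic = ×-decTotalOrder ≤-decTotalOrder ≤-decTotalOrder

  open InsertionSort lexicographic using (sort)
  open InsertionSortProperties lexicographic using (sort-↭; sort-↗)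

  sort-↭-injective : ∀ {L M} → L ↭ M → sort L ≡ sort M
  sort-↭-injective {L} {M} L↭M = Pointwise-≡⇒≡ (Pointwise.map ≡×≡⇒≡ (↗↭↗⇒≋ totalOrder (sort-↗ L) (sort-↗ M)
    (↭⇒↭ₛ′ ≈-isEquivalence (↭-trans (sort-↭ L) (↭-trans L↭M (↭-sym (sort-↭ M)))))))
    where open DecTotalOrder lexicographic using (totalOrder) renaming (isEquivalence to ≈-isEquivalence)

  _↭?_ : (L M : List OK) → Dec (L ↭ M)
  L ↭? M = map′ (λ sL≡sM → ↭-trans (↭-sym (sort-↭ L)) (subst (_↭ M) (sym sL≡sM) (sort-↭ M))) sort-↭-injective
                (List.≡-dec _≟ᴷ_ (sort L) (sort M))

  listsUpTo : ℕ → List OK → List (List OK)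
  listsUpTo zero    S = [] ∷ []
  listsUpTo (suc k) S = [] ∷ concatMap (λ x → map (x ∷_) (listsUpTo k S)) S

  ∈-listsUpTo : ∀ k S {L} → All (_∈ S) L → length L ℕ.≤ k → L ∈ listsUpTo k S
  ∈-listsUpTo zero    S All.[]             _           = here refl
  ∈-listsUpTo (suc k) S All.[]             _           = here refl
  ∈-listsUpTo (suc k) S (x∈S All.∷ L∈S) (s≤s |L|≤k) =
    there (∈-concat⁺′ (∈-map⁺ (_ ∷_) (∈-listsUpTo k S L∈S |L|≤k)) (∈-map⁺ (λ x → map (x ∷_) (listsUpTo k S)) x∈S))

  IsListing : OK → List OK → List (List OK) → Set
  IsListing α S Ls = All (λ L → All (_∈ S) L × sumK L ≡ α × 0 ℕ.< length L) Ls × AllPairs (λ L M → ¬ (L ↭ M)) Ls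

  isListing? : ∀ α S Ls → Dec (IsListing α S Ls)
  isListing? α S Ls =
    all? (λ L → all? (λ x → Any.any? (x ≟ᴷ_) S) L ×-dec (sumK L ≟ᴷ α) ×-dec (0 ℕ.<? length L)) Ls
    ×-dec allPairs? (λ L M → ¬? (L ↭? M)) Ls

  IsExhaustive : OK → ℕ → List OK → List (List OK) → Set
  IsExhaustive α k S Ls = All (λ L → sumK L ≡ α → Any (L ↭_) Ls) (listsUpTo k S)

  isExhaustive? : ∀ α k S Ls → Dec (IsExhaustive α k S Ls)
  isExhaustive? α k S Ls = all? (λ L → (sumK L ≟ᴷ α) →-dec any? (L ↭?_) Ls) (listsUpTo k S)

  module _ {C : OK → Set} (cone : IsCone C) where

    open IsCone cone

    sum-closed₀ : ∀ {L} → All C L → OrZero C (sumK L)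
    sum-closed₀ All.[]         = inj₁ refl
    sum-closed₀ (Cx All.∷ CL) = inj₂ (⊕-closed₀ Cx (sum-closed₀ CL))

    complement-closed₀ : ∀ {L x} → All C L → x ∈ L → OrZero C (sumK L ⊖ x)
    complement-closed₀ {y ∷ L} (Cy All.∷ CL) (here refl) = subst (OrZero C) (sym (⊕-⊖-cancelˡ y (sumK L))) (sum-closed₀ CL)
    complement-closed₀ {y ∷ L} {x} (Cy All.∷ CL) (there x∈L) =
      subst (OrZero C) (sym (⊕-⊖-assoc y (sumK L) x)) (inj₂ (⊕-closed₀ Cy (complement-closed₀ CL x∈L)))

    partAtLeast-by-listing : ∀ {α S Ls} → All C S → IsListing α S Ls → PartAtLeastOf C α (length Ls)
    partAtLeast-by-listing CS (reps , distinct) =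
      _ , ℕ.≤-refl ,
      All.map (λ (L∈S , ΣL≡α , 0<|L|) → (λ { refl → ℕ.<-irrefl refl 0<|L| }) , All.map (All.lookup CS) L∈S , ΣL≡α) reps ,
      distinct

    partCount-by-enumeration : ∀ {α k S Ls} → All C S →
      (∀ {x} → C x → OrZero C (α ⊖ x) → x ∈ S) →
      (∀ {L} → All C L → sumK L ≡ α → length L ℕ.≤ k) →
      IsListing α S Ls → IsExhaustive α k S Ls → PartCountOf C α (length Ls)
    partCount-by-enumeration {α} {k} {S} {Ls} CS parts∈S |L|≤k listing exhaustive =
      let (_ , _ , reps , distinct) = partAtLeast-by-listing CS listing
      in Ls , refl , reps , distinct , λ L (_ , CL , ΣL≡α) →
        All.lookup exhaustive (∈-listsUpTo k S (All.tabulate (λ x∈L → parts∈S (All.lookup CL x∈L)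
          (subst (λ β → OrZero C (β ⊖ _)) ΣL≡α (complement-closed₀ CL x∈L)))) (|L|≤k CL ΣL≡α)) ΣL≡α

  -- The partitions of 2β₀ + β₁

  interval : ℤ → ℕ → List ℤ
  interval lo zero    = []
  interval lo (suc n) = lo ∷ interval (1ℤ + lo) n

  ∈-interval : ∀ {lo s} n → lo ≤ s → s < lo + + n → s ∈ interval lo n
  ∈-interval {lo} {s} zero    lo≤s s<lo+0 = ⊥-elim (<-irrefl refl (<-≤-trans s<lo+0 (subst (_≤ s) (sym (+-identityʳ lo)) lo≤s)))
  ∈-interval {lo} {s} (suc n) lo≤s s<lo+1+n with lo ≟ s
  ... | yes refl  = here refl
  ... | no  lo≢s = there (∈-interval n (i<j⇒suc[i]≤j (≤∧≢⇒< lo≤s lo≢s)) (subst (s <_) (shift lo (+ n)) s<lo+1+n))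
    where shift : ∀ lo m → lo + (1ℤ + m) ≡ (1ℤ + lo) + m
          shift = solve-∀

  -- What C (s , t) implies once (A , -1), (-1 , B) and the points of F are known to lie outside the cone C.
  Admissible : ℤ → ℤ → List OK → OK → Set
  Admissible A B F (s , t) = 0ℤ < s + t × (t < 0ℤ → 0ℤ < s + A * t) × (s < 0ℤ → 0ℤ < t + B * s) × ¬ (s , t) ∈ F

  admissible? : ∀ A B F x → Dec (Admissible A B F x)
  admissible? A B F (s , t) =
    (0ℤ <? s + t) ×-dec (t <? 0ℤ →-dec 0ℤ <? s + A * t) ×-dec (s <? 0ℤ →-dec 0ℤ <? t + B * s) ×-dec ¬? (Any.any? ((s , t) ≟ᴷ_) F)

  -- 2β₀ + β₁, in coordinates (s , t) standing for s β₀ + t β₁.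
  α : OK
  α = + 2 , 1ℤ

  box : List OK
  box = cartesianProduct (interval -1ℤ 5) (interval (- + 2) 6)

  Classifies : ℤ → ℤ → List OK → List OK → Set
  Classifies A B F S = All (λ x → Admissible A B F x → OrZero (Admissible A B F) (α ⊖ x) → x ∈ S) box

  classifies? : ∀ A B F S → Dec (Classifies A B F S)
  classifies? A B F S =
    all? (λ x → admissible? A B F x →-dec ((α ⊖ x) ≟ᴷ 0K ⊎-dec admissible? A B F (α ⊖ x)) →-dec Any.any? (x ≟ᴷ_) S) box

  private
    0≤e-1 : ∀ {e} → 0ℤ < e → 0ℤ ≤ e - 1ℤ
    0≤e-1 0<e = i≤j⇒0≤j-i (i<j⇒suc[i]≤j 0<e)

    0≤-by : ∀ e p q → e ≡ p + q → 0ℤ ≤ p → 0ℤ ≤ q → 0ℤ ≤ e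
    0≤-by e p q refl = +-mono-≤

    0≤-cases : ∀ {e} t → (t < 0ℤ → 0ℤ ≤ e) → (0ℤ ≤ t → 0ℤ ≤ e) → 0ℤ ≤ e
    0≤-cases t if-neg if-nonneg with t <? 0ℤ
    ... | yes t<0 = if-neg t<0
    ... | no  t≮0 = if-nonneg (≮⇒≥ t≮0)

    steeper : ∀ {A s t} → + 2 ≤ A → t < 0ℤ → 0ℤ < s + A * t → 0ℤ < s + + 2 * t
    steeper {A} {s} {t} 2≤A t<0 0<s+At = subst (0ℤ <_) (regroup A s t)
      (+-mono-<-≤ 0<s+At (nonneg*nonneg (i≤j⇒0≤j-i 2≤A) (<⇒≤ (neg-mono-< t<0))))
      where regroup : ∀ A s t → s + A * t + (A - + 2) * - t ≡ s + + 2 * t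
            regroup = solve-∀

    in-box : ∀ {s t} → 0ℤ ≤ s + 1ℤ → 0ℤ ≤ + 3 - s → 0ℤ ≤ t + + 2 → 0ℤ ≤ + 3 - t → (s , t) ∈ box
    in-box 0≤s+1 0≤3-s 0≤t+2 0≤3-t = ∈-cartesianProduct⁺
      (∈-interval 5 (0≤i-j⇒j≤i 0≤s+1) (i≤pred[j]⇒i<j (0≤i-j⇒j≤i 0≤3-s)))
      (∈-interval 6 (0≤i-j⇒j≤i 0≤t+2) (i≤pred[j]⇒i<j (0≤i-j⇒j≤i 0≤3-t)))

  α∈box : α ∈ box
  α∈box = toWitness {a? = any? (α ≟ᴷ_) box} _

  -- x and α - x both have weight s + t ≥ 1, so s + t ∈ {1 , 2}; slope 2 on one side bounds the other coordinate.
  admissible-in-box : ∀ {A B F x} → + 2 ≤ A ⊎ + 2 ≤ B → Admissible A B F x → OrZero (Admissible A B F) (α ⊖ x) → x ∈ box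
  admissible-in-box {x = s , t} _ _ (inj₁ α-x≡0) =
    subst (_∈ box) (cong₂ _,_ (i-j≡0⇒i≡j (+ 2) s (cong proj₁ α-x≡0)) (i-j≡0⇒i≡j 1ℤ t (cong proj₂ α-x≡0)))
      α∈box
  admissible-in-box {A} {x = s , t} (inj₁ 2≤A) (0<s+t , slope , _ , _) (inj₂ (0<s′+t′ , slope′ , _ , _)) =
    in-box (0≤-by (s + 1ℤ) (s + t - 1ℤ) (+ 2 - t) (solve (s ∷ t ∷ [])) (0≤e-1 0<s+t) 0≤2-t)
           (0≤-by (+ 3 - s) (+ 2 - s + (1ℤ - t) - 1ℤ) (t + 1ℤ) (solve (s ∷ t ∷ [])) (0≤e-1 0<s′+t′) 0≤t+1)
           (0≤-by (t + + 2) (t + 1ℤ) 1ℤ (solve (t ∷ [])) 0≤t+1 (+≤+ z≤n))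
           (0≤-by (+ 3 - t) (+ 2 - t) 1ℤ (solve (t ∷ [])) 0≤2-t (+≤+ z≤n))
    where
      0≤t+1 : 0ℤ ≤ t + 1ℤ
      0≤t+1 = 0≤-cases t
        (λ t<0 → 0≤-by (t + 1ℤ) (s + + 2 * t - 1ℤ) (+ 2 - s + (1ℤ - t) - 1ℤ) (solve (s ∷ t ∷ []))
                   (0≤e-1 (steeper {A} {s} {t} 2≤A t<0 (slope t<0))) (0≤e-1 0<s′+t′))
        (λ 0≤t → 0≤-by (t + 1ℤ) t 1ℤ refl 0≤t (+≤+ z≤n))
      0≤2-t : 0ℤ ≤ + 2 - t
      0≤2-t = 0≤-cases (1ℤ - t)
        (λ 1-t<0 → 0≤-by (+ 2 - t) (+ 2 - s + + 2 * (1ℤ - t) - 1ℤ) (s + t - 1ℤ) (solve (s ∷ t ∷ []))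
                     (0≤e-1 (steeper {A} {+ 2 - s} {1ℤ - t} 2≤A 1-t<0 (slope′ 1-t<0))) (0≤e-1 0<s+t))
        (λ 0≤1-t → 0≤-by (+ 2 - t) (1ℤ - t) 1ℤ (solve (t ∷ [])) 0≤1-t (+≤+ z≤n))
  admissible-in-box {B = B} {x = s , t} (inj₂ 2≤B) (0<s+t , _ , slope , _) (inj₂ (0<s′+t′ , _ , slope′ , _)) =
    in-box 0≤s+1 0≤3-s
           (0≤-by (t + + 2) (s + t - 1ℤ) (+ 3 - s) (solve (s ∷ t ∷ [])) (0≤e-1 0<s+t) 0≤3-s)
           (0≤-by (+ 3 - t) (+ 2 - s + (1ℤ - t) - 1ℤ) (s + 1ℤ) (solve (s ∷ t ∷ [])) (0≤e-1 0<s′+t′) 0≤s+1)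
    where
      0≤s+1 : 0ℤ ≤ s + 1ℤ
      0≤s+1 = 0≤-cases s
        (λ s<0 → 0≤-by (s + 1ℤ) (t + + 2 * s - 1ℤ) (+ 2 - s + (1ℤ - t) - 1ℤ) (solve (s ∷ t ∷ []))
                   (0≤e-1 (steeper {B} {t} {s} 2≤B s<0 (slope s<0))) (0≤e-1 0<s′+t′))
        (λ 0≤s → 0≤-by (s + 1ℤ) s 1ℤ refl 0≤s (+≤+ z≤n))
      0≤3-s : 0ℤ ≤ + 3 - s
      0≤3-s = 0≤-cases (+ 2 - s)
        (λ 2-s<0 → 0≤-by (+ 3 - s) (1ℤ - t + + 2 * (+ 2 - s) - 1ℤ) (s + t - 1ℤ) (solve (s ∷ t ∷ []))
                     (0≤e-1 (steeper {B} {1ℤ - t} {+ 2 - s} 2≤B 2-s<0 (slope′ 2-s<0))) (0≤e-1 0<s+t))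
        (λ 0≤2-s → 0≤-by (+ 3 - s) (+ 2 - s) 1ℤ (solve (s ∷ [])) 0≤2-s (+≤+ z≤n))

  -- C stands for O_K^+ in these coordinates.
  module Frame {C : OK → Set} (cone : IsCone C) (v₋₁ v₀ v₁ : ℕ)
    (e₀-indec : IndecomposableIn C (1ℤ , 0ℤ)) (e₁-indec : IndecomposableIn C (0ℤ , 1ℤ))
    (b₋₁-indec : IndecomposableIn C (+ v₀ , -1ℤ)) (b₂-indec : IndecomposableIn C (-1ℤ , + v₁))
    (b₋₂-indec : IndecomposableIn C (+ v₋₁ * + v₀ - 1ℤ , - + v₋₁))
    where

    open IsCone cone

    private
      Ce₀ = proj₁ e₀-indec
      Ce₁ = proj₁ e₁-indec

    not-a-summand : ∀ x {y z} → IndecomposableIn C z → C y → z ≡ x ⊕ y → ¬ C x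
    not-a-summand x (_ , z-indec) Cy z≡x⊕y Cx = z-indec (x , _ , Cx , Cy , z≡x⊕y)

    ¬C[1,-1] : ¬ C (1ℤ , -1ℤ)
    ¬C[1,-1] = not-a-summand (1ℤ , -1ℤ) e₀-indec Ce₁ refl

    ¬C[-1,1] : ¬ C (-1ℤ , 1ℤ)
    ¬C[-1,1] = not-a-summand (-1ℤ , 1ℤ) e₁-indec Ce₀ refl

    ¬C-left-of-b₋₁ : ∀ {A} → A < + v₀ → ¬ C (A , -1ℤ)
    ¬C-left-of-b₋₁ {A} A<v₀ = not-a-summand (A , -1ℤ) b₋₁-indec (⋆-closed (i<j⇒0<j-i A<v₀) Ce₀)
      (cong₂ _,_ (shift A (+ v₀)) (stay A (+ v₀)))
      where
        shift : ∀ A v → v ≡ A + (v - A) * 1ℤ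
        shift = solve-∀
        stay : ∀ A v → -1ℤ ≡ -1ℤ + (v - A) * 0ℤ
        stay = solve-∀

    ¬C-below-b₂ : ∀ {B} → B < + v₁ → ¬ C (-1ℤ , B)
    ¬C-below-b₂ {B} B<v₁ = not-a-summand (-1ℤ , B) b₂-indec (⋆-closed (i<j⇒0<j-i B<v₁) Ce₁)
      (cong₂ _,_ (stay B (+ v₁)) (shift B (+ v₁)))
      where
        shift : ∀ B v → v ≡ B + (v - B) * 1ℤ
        shift = solve-∀
        stay : ∀ B v → -1ℤ ≡ -1ℤ + (v - B) * 0ℤ
        stay = solve-∀

    2≤v₁ : 2 ℕ.≤ v₁
    2≤v₁ = at-least-2 v₁ (proj₁ b₂-indec)
      where
        at-least-2 : ∀ v → C (-1ℤ , + v) → 2 ℕ.≤ v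
        at-least-2 0             C[-1,0] = ⊥-elim (¬C[-1,1] (⊕-closed C[-1,0] Ce₁))
        at-least-2 1             C[-1,1] = ⊥-elim (¬C[-1,1] C[-1,1])
        at-least-2 (suc (suc _)) _       = s≤s (s≤s z≤n)

    slope-below : ∀ {A s t} → ¬ C (A , -1ℤ) → C (s , t) → t < 0ℤ → 0ℤ < s + A * t
    slope-below {A} {s} {t} ¬C[A,-1] Cx t<0 with 0ℤ <? s + A * t
    ... | yes 0<s+At = 0<s+At
    ... | no  s+At≮0 = ⊥-elim (¬C[A,-1] (⋆-cancel (neg-mono-< t<0)
          (subst C (cong₂ _,_ (first A s t) (second A s t)) (⊕-closed₀ Cx (⋆-closed₀ (neg-mono-≤ (≮⇒≥ s+At≮0)) Ce₀)))))
      where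
        first : ∀ A s t → s + (- (s + A * t)) * 1ℤ ≡ - t * A
        first = solve-∀
        second : ∀ A s t → t + (- (s + A * t)) * 0ℤ ≡ - t * -1ℤ
        second = solve-∀

    slope-left : ∀ {B s t} → ¬ C (-1ℤ , B) → C (s , t) → s < 0ℤ → 0ℤ < t + B * s
    slope-left {B} {s} {t} ¬C[-1,B] Cx s<0 with 0ℤ <? t + B * s
    ... | yes 0<t+Bs = 0<t+Bs
    ... | no  t+Bs≮0 = ⊥-elim (¬C[-1,B] (⋆-cancel (neg-mono-< s<0)
          (subst C (cong₂ _,_ (first B s t) (second B s t)) (⊕-closed₀ Cx (⋆-closed₀ (neg-mono-≤ (≮⇒≥ t+Bs≮0)) Ce₁)))))
      where
        first : ∀ B s t → s + (- (t + B * s)) * 0ℤ ≡ - s * -1ℤ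
        first = solve-∀
        second : ∀ B s t → t + (- (t + B * s)) * 1ℤ ≡ - s * B
        second = solve-∀

    weight-pos : ∀ {s t} → C (s , t) → 0ℤ < s + t
    weight-pos {s} {t} Cx with t <? 0ℤ | s <? 0ℤ
    ... | yes t<0 | _       = subst (λ z → 0ℤ < s + z) (*-identityˡ t) (slope-below ¬C[1,-1] Cx t<0)
    ... | no  _   | yes s<0 = subst (0ℤ <_) (trans (cong (λ z → t + z) (*-identityˡ s)) (+-comm t s)) (slope-left ¬C[-1,1] Cx s<0)
    ... | no  t≮0 | no  s≮0 with <-cmp 0ℤ s | <-cmp 0ℤ t
    ...   | tri< 0<s _ _  | _             = +-mono-<-≤ 0<s (≮⇒≥ t≮0)
    ...   | tri≈ _ 0≡s _  | tri< 0<t _ _  = +-mono-≤-< (≤-reflexive 0≡s) 0<t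
    ...   | tri≈ _ refl _ | tri≈ _ refl _ = ⊥-elim (0∉ Cx)
    ...   | tri> _ _ s<0  | _             = ⊥-elim (s≮0 s<0)
    ...   | tri≈ _ _ _    | tri> _ _ t<0  = ⊥-elim (t≮0 t<0)

    admissible : ∀ {A B F x} → ¬ C (A , -1ℤ) → ¬ C (-1ℤ , B) → All (λ p → ¬ C p) F → C x → Admissible A B F x
    admissible ¬C[A,-1] ¬C[-1,B] ¬CF Cx =
      weight-pos Cx , slope-below ¬C[A,-1] Cx , slope-left ¬C[-1,B] Cx , λ x∈F → All.lookup ¬CF x∈F Cx

    length≤3 : ∀ {L} → All C L → sumK L ≡ α → length L ℕ.≤ 3
    length≤3 {L} CL ΣL≡α = drop‿+≤+ (subst (λ β → + length L ≤ proj₁ β + proj₂ β) ΣL≡α (length≤weight CL))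
      where
        length≤weight : ∀ {L} → All C L → + length L ≤ proj₁ (sumK L) + proj₂ (sumK L)
        length≤weight All.[]                 = +≤+ z≤n
        length≤weight {(s , t) ∷ L} (Cx All.∷ CL) = subst (+ suc (length L) ≤_) (interchange s t (proj₁ (sumK L)) (proj₂ (sumK L)))
          (+-mono-≤ (i<j⇒suc[i]≤j (weight-pos Cx)) (length≤weight CL))

    partCount-α-by-slopes : ∀ {A B} F S Ls → + 2 ≤ A ⊎ + 2 ≤ B → ¬ C (A , -1ℤ) → ¬ C (-1ℤ , B) → All (λ x → ¬ C x) F → All C S →
                  True (classifies? A B F S) → True (isListing? α S Ls) → True (isExhaustive? α 3 S Ls) →
                  PartCountOf C α (length Ls)
    partCount-α-by-slopes F S Ls 2≤A⊎2≤B ¬C[A,-1] ¬C[-1,B] ¬CF CS classified listed exhausted =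
      partCount-by-enumeration cone CS summand∈S length≤3 (toWitness listed) (toWitness exhausted)
      where
        summand∈S : ∀ {x} → C x → OrZero C (α ⊖ x) → x ∈ S
        summand∈S Cx C₀α-x = All.lookup (toWitness classified) (admissible-in-box 2≤A⊎2≤B adm adm′) adm adm′
          where
            adm = admissible ¬C[A,-1] ¬C[-1,B] ¬CF Cx
            adm′ = map₂ (admissible ¬C[A,-1] ¬C[-1,B] ¬CF) C₀α-x

    private
      basic : List OK
      basic = (1ℤ , 0ℤ) ∷ (0ℤ , 1ℤ) ∷ (+ 2 , 0ℤ) ∷ (1ℤ , 1ℤ) ∷ (+ 2 , 1ℤ) ∷ []

      C-basic : All C basic
      C-basic = Ce₀ All.∷ Ce₁ All.∷ ⊕-closed Ce₀ Ce₀ All.∷ ⊕-closed Ce₀ Ce₁ All.∷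
                ⊕-closed (⊕-closed Ce₀ Ce₀) Ce₁ All.∷ All.[]

      basic-partitions : List (List OK)
      basic-partitions =
        ((+ 2 , 1ℤ) ∷ []) ∷ ((1ℤ , 1ℤ) ∷ (1ℤ , 0ℤ) ∷ []) ∷ ((+ 2 , 0ℤ) ∷ (0ℤ , 1ℤ) ∷ []) ∷
        ((1ℤ , 0ℤ) ∷ (1ℤ , 0ℤ) ∷ (0ℤ , 1ℤ) ∷ []) ∷ []

      C-b₋₁ : ∀ {n} → v₀ ≡ n → C (+ n , -1ℤ)
      C-b₋₁ refl = proj₁ b₋₁-indec

      C-b₂ : ∀ {n} → v₁ ≡ n → C (-1ℤ , + n)
      C-b₂ refl = proj₁ b₂-indec

      below-b₋₁ : ∀ {m n} → v₀ ≡ n → m ℕ.< n → ¬ C (+ m , -1ℤ)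
      below-b₋₁ refl m<v₀ = ¬C-left-of-b₋₁ (+<+ m<v₀)

      below-b₂ : ∀ {m n} → v₁ ≡ n → m ℕ.< n → ¬ C (-1ℤ , + m)
      below-b₂ refl m<v₁ = ¬C-below-b₂ (+<+ m<v₁)

    partCount-v₀≥3 : 3 ℕ.≤ v₀ → ¬ (v₀ ≡ 3 × v₁ ≡ 2) → PartCountOf C α 4
    partCount-v₀≥3 3≤v₀ ¬[v₀,v₁]≡[3,2] with 3 ℕ.≤? v₁
    ... | yes 3≤v₁ = partCount-α-by-slopes [] basic basic-partitions (inj₁ ≤-refl)
                       (below-b₋₁ refl 3≤v₀) (below-b₂ refl 3≤v₁) All.[] C-basic _ _ _
    ... | no  3≰v₁ = partCount-α-by-slopes [] basic basic-partitions (inj₁ (+≤+ (s≤s (s≤s z≤n))))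
                       (below-b₋₁ refl 4≤v₀) (below-b₂ refl 2≤v₁) All.[] C-basic _ _ _
      where
        v₁≡2 = ℕ.≤-antisym (ℕ.≤-pred (ℕ.≰⇒> 3≰v₁)) 2≤v₁
        4≤v₀ = ℕ.≤∧≢⇒< 3≤v₀ (λ 3≡v₀ → ¬[v₀,v₁]≡[3,2] (sym 3≡v₀ , v₁≡2))

    partCount-v₀≡3-v₁≡2 : v₀ ≡ 3 → v₁ ≡ 2 → PartCountOf C α 5
    partCount-v₀≡3-v₁≡2 v₀≡3 v₁≡2 =
      partCount-α-by-slopes [] (basic ++ (+ 3 , -1ℤ) ∷ (-1ℤ , + 2) ∷ [])
        (basic-partitions ++ ((-1ℤ , + 2) ∷ (+ 3 , -1ℤ) ∷ []) ∷ [])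
        (inj₁ ≤-refl) (below-b₋₁ v₀≡3 ℕ.≤-refl) (below-b₂ v₁≡2 ℕ.≤-refl) All.[]
        (All.++⁺ C-basic (C-b₋₁ v₀≡3 All.∷ C-b₂ v₁≡2 All.∷ All.[])) _ _ _

    private
      C[0,2] : C (0ℤ , + 2)
      C[0,2] = ⊕-closed Ce₁ Ce₁

      partitions-with-b₋₁ : List (List OK)
      partitions-with-b₋₁ = ((0ℤ , 1ℤ) ∷ (0ℤ , 1ℤ) ∷ (+ 2 , -1ℤ) ∷ []) ∷ ((0ℤ , + 2) ∷ (+ 2 , -1ℤ) ∷ []) ∷ []

    partCount-v₀≡2-v₁≥4 : v₀ ≡ 2 → 4 ℕ.≤ v₁ → PartCountOf C α 6
    partCount-v₀≡2-v₁≥4 v₀≡2 4≤v₁ =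
      partCount-α-by-slopes [] (basic ++ (+ 2 , -1ℤ) ∷ (0ℤ , + 2) ∷ []) (basic-partitions ++ partitions-with-b₋₁)
        (inj₂ (+≤+ (s≤s (s≤s z≤n)))) (below-b₋₁ v₀≡2 ℕ.≤-refl) (below-b₂ refl 4≤v₁) All.[]
        (All.++⁺ C-basic (C-b₋₁ v₀≡2 All.∷ C[0,2] All.∷ All.[])) _ _ _

    partCount-v₀≡2-v₁≡3-v₋₁>2 : v₀ ≡ 2 → v₁ ≡ 3 → 2 ℕ.< v₋₁ → PartCountOf C α 6
    partCount-v₀≡2-v₁≡3-v₋₁>2 v₀≡2 v₁≡3 2<v₋₁ =
      partCount-α-by-slopes ((+ 3 , - + 2) ∷ []) (basic ++ (+ 2 , -1ℤ) ∷ (0ℤ , + 2) ∷ []) (basic-partitions ++ partitions-with-b₋₁)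
        (inj₂ ≤-refl) (below-b₋₁ v₀≡2 ℕ.≤-refl) (below-b₂ v₁≡3 ℕ.≤-refl) (¬C[3,-2] All.∷ All.[])
        (All.++⁺ C-basic (C-b₋₁ v₀≡2 All.∷ C[0,2] All.∷ All.[])) _ _ _
      where
        ¬C[3,-2] : ¬ C (+ 3 , - + 2)
        ¬C[3,-2] = not-a-summand (+ 3 , - + 2) (subst (λ v → IndecomposableIn C (+ v₋₁ * + v - 1ℤ , - + v₋₁)) v₀≡2 b₋₂-indec)
          (⋆-closed (i<j⇒0<j-i (+<+ 2<v₋₁)) (C-b₋₁ v₀≡2)) (cong₂ _,_ (first (+ v₋₁)) (second (+ v₋₁)))
          where
            first : ∀ v → v * + 2 - 1ℤ ≡ + 3 + (v - + 2) * + 2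
            first = solve-∀
            second : ∀ v → - v ≡ - + 2 + (v - + 2) * -1ℤ
            second = solve-∀

    partCount-v₀≡2-v₁≡3-v₋₁≡2 : v₀ ≡ 2 → v₁ ≡ 3 → v₋₁ ≡ 2 → PartCountOf C α 7
    partCount-v₀≡2-v₁≡3-v₋₁≡2 v₀≡2 v₁≡3 v₋₁≡2 =
      partCount-α-by-slopes [] (basic ++ (+ 2 , -1ℤ) ∷ (0ℤ , + 2) ∷ (+ 3 , - + 2) ∷ (-1ℤ , + 3) ∷ [])
        (basic-partitions ++ partitions-with-b₋₁ ++ ((-1ℤ , + 3) ∷ (+ 3 , - + 2) ∷ []) ∷ [])
        (inj₂ ≤-refl) (below-b₋₁ v₀≡2 ℕ.≤-refl) (below-b₂ v₁≡3 ℕ.≤-refl) All.[]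
        (All.++⁺ C-basic (C-b₋₁ v₀≡2 All.∷ C[0,2] All.∷ C[3,-2] All.∷ C-b₂ v₁≡3 All.∷ All.[])) _ _ _
      where
        C[3,-2] : C (+ 3 , - + 2)
        C[3,-2] = subst₂ (λ u v → C (+ u * + v - 1ℤ , - + u)) v₋₁≡2 v₀≡2 (proj₁ b₋₂-indec)

    partAtLeast-v₀≡2-v₁≡2 : v₀ ≡ 2 → v₁ ≡ 2 → PartAtLeastOf C α 8
    partAtLeast-v₀≡2-v₁≡2 v₀≡2 v₁≡2 = partAtLeast-by-listing cone
      {S = basic ++ (+ 2 , -1ℤ) ∷ (0ℤ , + 2) ∷ (-1ℤ , + 2) ∷ (+ 3 , -1ℤ) ∷ []}
      {Ls = basic-partitions ++ partitions-with-b₋₁ ++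
            ((+ 2 , -1ℤ) ∷ (1ℤ , 0ℤ) ∷ (-1ℤ , + 2) ∷ []) ∷ ((+ 3 , -1ℤ) ∷ (-1ℤ , + 2) ∷ []) ∷ []}
      (All.++⁺ C-basic (C-b₋₁ v₀≡2 All.∷ C[0,2] All.∷ C-b₂ v₁≡2 All.∷ ⊕-closed (C-b₋₁ v₀≡2) Ce₀ All.∷ All.[]))
      (toWitness {a? = isListing? α _ _} _)

open import Data.Nat using (ℕ; _≤_; _<_)
open import Data.Product using (_×_; _,_; proj₁; proj₂)
open import Relation.Nullary using (¬_)
open import Relation.Binary.PropositionalEquality using (_≡_; subst)
open import Function using (_∘_)

lemma7p6 : (D : ℕ) → 2 ≤ D → Squarefree D →
    (b₋₂ b₋₁ b₀ b₁ b₂ : OK) →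
    Consecutive D b₋₂ b₋₁ → Consecutive D b₋₁ b₀ →
    Consecutive D b₀ b₁ → Consecutive D b₁ b₂ →
    (v₋₁ v₀ v₁ : ℕ) →
    v₋₁ · b₋₁ ≡ b₋₂ ⊕ b₀ → v₀ · b₀ ≡ b₋₁ ⊕ b₁ → v₁ · b₁ ≡ b₀ ⊕ b₂ →
    ((3 ≤ v₀ → ¬ (v₀ ≡ 3 × v₁ ≡ 2) → PartCount D ((2 · b₀) ⊕ b₁) 4)
    × (v₀ ≡ 3 → v₁ ≡ 2 → PartCount D ((2 · b₀) ⊕ b₁) 5)
    × (v₀ ≡ 2 → 4 ≤ v₁ → PartCount D ((2 · b₀) ⊕ b₁) 6)
    × (v₀ ≡ 2 → v₁ ≡ 3 → 2 < v₋₁ → PartCount D ((2 · b₀) ⊕ b₁) 6)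
    × (v₀ ≡ 2 → v₁ ≡ 3 → v₋₁ ≡ 2 → PartCount D ((2 · b₀) ⊕ b₁) 7)
    × (v₀ ≡ 2 → v₁ ≡ 2 → PartAtLeast D ((2 · b₀) ⊕ b₁) 8))
lemma7p6 D 2≤D sf b₋₂ b₋₁ b₀ b₁ b₂ b₋₂b₋₁ b₋₁b₀ b₀b₁ b₁b₂ v₋₁ v₀ v₁ rec₋₁ rec₀ rec₁ =
    (λ 3≤v₀ ¬[3,2] → count (partCount-v₀≥3 3≤v₀ ¬[3,2]))
  , (λ v₀≡3 v₁≡2 → count (partCount-v₀≡3-v₁≡2 v₀≡3 v₁≡2))
  , (λ v₀≡2 4≤v₁ → count (partCount-v₀≡2-v₁≥4 v₀≡2 4≤v₁))
  , (λ v₀≡2 v₁≡3 2<v₋₁ → count (partCount-v₀≡2-v₁≡3-v₋₁>2 v₀≡2 v₁≡3 2<v₋₁))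
  , (λ v₀≡2 v₁≡3 v₋₁≡2 → count (partCount-v₀≡2-v₁≡3-v₋₁≡2 v₀≡2 v₁≡3 v₋₁≡2))
  , (λ v₀≡2 v₁≡2 → at-least (partAtLeast-v₀≡2-v₁≡2 v₀≡2 v₁≡2))
  where
    open Coordinates sf 2≤D b₀b₁
    open Frame cone v₋₁ v₀ v₁
      (indecomposable-coordinates combine-e₀ (proj₁ b₀b₁))
      (indecomposable-coordinates combine-e₁ (proj₁ (proj₂ b₀b₁)))
      (indecomposable-coordinates (combine-b₋₁ {v₀} rec₀) (proj₁ b₋₁b₀))
      (indecomposable-coordinates (combine-b₂ {v₁} rec₁) (proj₁ (proj₂ b₁b₂)))
      (indecomposable-coordinates (combine-b₋₂ {v₋₁} {v₀} rec₋₁ (combine-b₋₁ {v₀} rec₀)) (proj₁ b₋₂b₋₁))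

    count : ∀ {n} → PartCountOf Cone α n → PartCount D ((2 · b₀) ⊕ b₁) n
    count = subst (λ β → PartCount D β _) combine-α ∘ partCount-combine

    at-least : ∀ {n} → PartAtLeastOf Cone α n → PartAtLeast D ((2 · b₀) ⊕ b₁) n
    at-least = subst (λ β → PartAtLeast D β _) combine-α ∘ partAtLeast-combine
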